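{- Let $X=\{x,y,z\}$ and $N=\{1,\dots,n\}$ with $n\ge 3$, and let $g:NP\to X$ be a strategy-proof social choice rule. If $g|NP^{*}$ has a range consisting of exactly two alternatives, then $g$ is not of full range on $NP$, i.e. $\mathrm{Range}(g)\neq X$.
   Context: A profile is a map $p:N\to L(X)$, where $L(X)$ is the set of strict linear orderings of $X$; write $a\succ_{p(i)}b$ if individual $i$ strictly prefers $a$ to $b$ at $p$. $NP$ is the set of all profiles $p$ such that for every pair of distinct alternatives $a,b$ there exist individuals $i,j$ with $a\succ_{p(i)}b$ and $b\succ_{p(j)}a$. $NP^{*}$ is the set of profiles $u\in NP$ with $u(n-1)=u(n)$. Two profiles $p,q$ are $h$-variants if $q(i)=p(i)$ for all $i\neq h$. A rule $g:NP\to X$ is strategy-proof if there are no $h\in N$ and $h$-variants $p,p'\in NP$ with $g(p')\succ_{p(h)}g(p)$. -}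

module Defs where

open import Data.Nat using (ℕ; suc)
open import Data.Fin using (Fin; zero; suc; fromℕ; inject₁)
open import Data.Product using (Σ; ∃; _×_; _,_)
open import Data.Empty using (⊥)
open import Data.Unit using (⊤)
import Data.Nat
import Data.Sum
open import Relation.Nullary using (¬_)
open import Relation.Binary.PropositionalEquality using (_≡_)

data X : Set where
  x y z : X

-- L(X): the six strict linear orderings of X, listed best-to-worst.
data L : Set where
  xyz xzy yxz yzx zxy zyx : L

-- position of an alternative in an ordering (0 = best)
rank : L → X → ℕ
rank xyz x = 0
rank xyz y = 1
rank xyz z = 2
rank xzy x = 0
rank xzy z = 1
rank xzy y = 2
rank yxz y = 0
rank yxz x = 1
rank yxz z = 2
rank yzx y = 0
rank yzx z = 1
rank yzx x = 2
rank zxy z = 0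
rank zxy x = 1
rank zxy y = 2
rank zyx z = 0
rank zyx y = 1
rank zyx x = 2

_≻[_]_ : X → L → X → Set
a ≻[ P ] b = Data.Nat._<_ (rank P a) (rank P b)

Profile : ℕ → Set
Profile n = Fin n → L

NP : ∀ {n} → Profile n → Set
NP {n} p = ∀ (a b : X) → ¬ (a ≡ b) →
  Σ (Fin n) λ i → Σ (Fin n) λ j → (a ≻[ p i ] b) × (b ≻[ p j ] a)

Variant : ∀ {n} → Fin n → Profile n → Profile n → Set
Variant {n} h p q = ∀ (i : Fin n) → ¬ (i ≡ h) → q i ≡ p i

Rule : ℕ → Set
Rule n = (p : Profile n) → NP p → X

StrategyProof : ∀ {n} → Rule n → Set
StrategyProof {n} g =
  ∀ (h : Fin n) (p p' : Profile n) (np : NP p) (np' : NP p') →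
    Variant h p p' → ¬ (g p' np' ≻[ p h ] g p np)

-- For n = m + 3 individuals: individual n is the last index, n-1 the one before.
lastI : (m : ℕ) → Fin (suc (suc (suc m)))
lastI m = fromℕ (suc (suc m))

penultI : (m : ℕ) → Fin (suc (suc (suc m)))
penultI m = inject₁ (fromℕ (suc m))

NPstar : (m : ℕ) → Profile (suc (suc (suc m))) → Set
NPstar m u = NP u × (u (penultI m) ≡ u (lastI m))

InRangeStar : (m : ℕ) → Rule (suc (suc (suc m))) → X → Set
InRangeStar m g a = Σ (Profile (suc (suc (suc m)))) λ u →
  Σ (NPstar m u) λ s → g u (Data.Product.proj₁ s) ≡ a

InRange : ∀ {n} → Rule n → X → Set
InRange {n} g a = Σ (Profile n) λ p → Σ (NP p) λ np → g p np ≡ a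

RangeStarExactlyTwo : (m : ℕ) → Rule (suc (suc (suc m))) → Set
RangeStarExactlyTwo m g = Σ X λ a → Σ X λ b →
  ¬ (a ≡ b) × InRangeStar m g a × InRangeStar m g b ×
  (∀ c → InRangeStar m g c → (c ≡ a) Data.Sum.⊎ (c ≡ b))

module Submission where

-- Relabelling the alternatives (Relabelled) we may assume Range(g|NP*) =
-- {x, y}, so z never wins when a and b agree, and we show that z never wins at all.
-- Suppose g(p) = z.  Fix a third voter o.
--   1. (Main.anchored) From p we reach a "z-anchored" profile: z wins, one of a, b
--      ranks z last and every other voter ranks z first.
--   2. (Reach.anchored⇒forced) Then z wins at every profile with a = xyz, b = zyx
--      and all others ranking z first (property ZForced).
--   3. (canonical-twin) Every NP* profile has a "canonical" twin with the same
--      outcome: a = b rank z last, everybody else ranks z first.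
--   4. (Forced.not-x-and-y) Under ZForced no canonical profile yields x while
--      another yields y -- but x and y both occur on NP*.
-- The moves between profiles are those controlled by strategy-proofness
-- (Strategyproof): monotonicity, raising z when z wins, free moves of a voter who
-- ranks the winner last, and x/y-preserving moves while the outcome stays in {x, y}.
-- The finite core of steps 1, 2 and 4 is propagation through outcome tables (Table):
-- the outcomes when three voters k, a, b range over all orderings.

open import Defs
open import Data.Nat as ℕ using (ℕ; zero; suc; _<ᵇ_)
open import Data.Nat.Properties as ℕP
  using (<ᵇ⇒<; <⇒<ᵇ; <-irrefl; <-asym; <-trans; <-cmp; m<n⇒m<1+n; m<1+n⇒m<n∨m≡n; ≮⇒≥; <⇒≢; 0≢1+n)
open import Data.Fin as Fin using (Fin; toℕ; fromℕ<; fromℕ; inject₁)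
open import Data.Fin.Properties using (toℕ-injective; toℕ<n; toℕ-fromℕ<; toℕ-inject₁; toℕ-fromℕ; any?)
  renaming (_≟_ to _≟F_)
open import Data.Vec.Functional using (updateAt)
open import Data.Vec.Functional.Properties using (updateAt-updates; updateAt-minimal)
open import Data.Product using (Σ; _×_; _,_; proj₁; proj₂)
open import Data.Sum as Sum using (_⊎_; inj₁; inj₂; reduce)
open import Data.Empty using (⊥; ⊥-elim)
open import Data.Bool using (Bool; true; false; T; _∨_; not)
open import Data.Bool.Properties using (T-≡; T-∨)
open import Function using (const; _∘_)
open import Function.Bundles using (Equivalence)
open import Relation.Nullary using (¬_; Dec; yes; no)
open import Relation.Nullary.Decidable using (¬?; _×-dec_)
open import Relation.Binary.PropositionalEquality
open import Relation.Binary using (tri<; tri≈; tri>)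


_≟X_ : (u v : X) → Dec (u ≡ v)
x ≟X x = yes refl
x ≟X y = no (λ ())
x ≟X z = no (λ ())
y ≟X x = no (λ ())
y ≟X y = yes refl
y ≟X z = no (λ ())
z ≟X x = no (λ ())
z ≟X y = no (λ ())
z ≟X z = yes refl

prefer : ∀ R u v → {T (rank R u <ᵇ rank R v)} → u ≻[ R ] v
prefer R u v {t} = <ᵇ⇒< (rank R u) (rank R v) t

≻-irrefl : ∀ {R u} → ¬ (u ≻[ R ] u)
≻-irrefl = <-irrefl refl

≻-asym : ∀ {R u v} → u ≻[ R ] v → ¬ (v ≻[ R ] u)
≻-asym = <-asym

-- The alternative at a given position; it inverts `rank`, so rank is injective.
at : L → ℕ → X
at xyz 0 = x
at xyz 1 = y
at xyz _ = z
at xzy 0 = x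
at xzy 1 = z
at xzy _ = y
at yxz 0 = y
at yxz 1 = x
at yxz _ = z
at yzx 0 = y
at yzx 1 = z
at yzx _ = x
at zxy 0 = z
at zxy 1 = x
at zxy _ = y
at zyx 0 = z
at zyx 1 = y
at zyx _ = x

at-rank : ∀ R u → at R (rank R u) ≡ u
at-rank xyz = λ { x → refl ; y → refl ; z → refl }
at-rank xzy = λ { x → refl ; y → refl ; z → refl }
at-rank yxz = λ { x → refl ; y → refl ; z → refl }
at-rank yzx = λ { x → refl ; y → refl ; z → refl }
at-rank zxy = λ { x → refl ; y → refl ; z → refl }
at-rank zyx = λ { x → refl ; y → refl ; z → refl }

≻-total : ∀ R u v → ¬ (u ≡ v) → (u ≻[ R ] v) ⊎ (v ≻[ R ] u)
≻-total R u v u≢v with <-cmp (rank R u) (rank R v)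
... | tri< u≻v _ _ = inj₁ u≻v
... | tri≈ _ same _ = ⊥-elim (u≢v (trans (sym (at-rank R u)) (trans (cong (at R) same) (at-rank R v))))
... | tri> _ _ v≻u = inj₂ v≻u

≻-complement : ∀ {R u v} → ¬ (u ≻[ R ] v) → (v ≡ u) ⊎ (v ≻[ R ] u)
≻-complement {R} {u} {v} u⊁v with u ≟X v
... | yes u≡v = inj₁ (sym u≡v)
... | no u≢v with ≻-total R u v u≢v
...   | inj₁ u≻v = ⊥-elim (u⊁v u≻v)
...   | inj₂ v≻u = inj₂ v≻u

isX : ∀ {w} → ¬ (w ≡ y) → ¬ (w ≡ z) → w ≡ x
isX {x} _ _ = refl
isX {y} w≢y _ = ⊥-elim (w≢y refl)
isX {z} _ w≢z = ⊥-elim (w≢z refl)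

isY : ∀ {w} → ¬ (w ≡ x) → ¬ (w ≡ z) → w ≡ y
isY {y} _ _ = refl
isY {x} w≢x _ = ⊥-elim (w≢x refl)
isY {z} _ w≢z = ⊥-elim (w≢z refl)

isZ : ∀ {w} → ¬ (w ≡ x) → ¬ (w ≡ y) → w ≡ z
isZ {z} _ _ = refl
isZ {x} w≢x _ = ⊥-elim (w≢x refl)
isZ {y} _ w≢y = ⊥-elim (w≢y refl)

caseX : ∀ {P : Set} (w : X) → (w ≡ x → P) → (w ≡ y → P) → (w ≡ z → P) → P
caseX x on-x _ _ = on-x refl
caseX y _ on-y _ = on-y refl
caseX z _ _ on-z = on-z refl

xy-equal : ∀ {u v : X} → ¬ (u ≡ z) → ¬ (v ≡ z) →
           (u ≡ x → v ≡ y → ⊥) → (u ≡ y → v ≡ x → ⊥) → u ≡ v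
xy-equal {x} {x} _ _ _ _ = refl
xy-equal {y} {y} _ _ _ _ = refl
xy-equal {x} {y} _ _ not-xy _ = ⊥-elim (not-xy refl refl)
xy-equal {y} {x} _ _ _ not-yx = ⊥-elim (not-yx refl refl)
xy-equal {z} u≢z _ _ _ = ⊥-elim (u≢z refl)
xy-equal {_} {z} _ v≢z _ _ = ⊥-elim (v≢z refl)

rev : L → L
rev xyz = zyx
rev xzy = yzx
rev yxz = zxy
rev yzx = xzy
rev zxy = yxz
rev zyx = xyz

raiseZ : L → L
raiseZ xyz = zxy
raiseZ xzy = zxy
raiseZ yxz = zyx
raiseZ yzx = zyx
raiseZ zxy = zxy
raiseZ zyx = zyx

Top : L → Set
Top R = (R ≡ zxy) ⊎ (R ≡ zyx)

Bot : L → Set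
Bot R = (R ≡ xyz) ⊎ (R ≡ yxz)

raiseZ-Top : ∀ R → Top (raiseZ R)
raiseZ-Top xyz = inj₁ refl
raiseZ-Top xzy = inj₁ refl
raiseZ-Top yxz = inj₂ refl
raiseZ-Top yzx = inj₂ refl
raiseZ-Top zxy = inj₁ refl
raiseZ-Top zyx = inj₂ refl

rev-raiseZ-Bot : ∀ R → Bot (rev (raiseZ R))
rev-raiseZ-Bot xyz = inj₂ refl
rev-raiseZ-Bot xzy = inj₂ refl
rev-raiseZ-Bot yxz = inj₁ refl
rev-raiseZ-Bot yzx = inj₁ refl
rev-raiseZ-Bot zxy = inj₂ refl
rev-raiseZ-Bot zyx = inj₁ refl

Top-z : ∀ {R} → Top R → ∀ u → ¬ (u ≡ z) → z ≻[ R ] u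
Top-z (inj₁ refl) x _ = prefer zxy z x
Top-z (inj₁ refl) y _ = prefer zxy z y
Top-z (inj₁ refl) z u≢z = ⊥-elim (u≢z refl)
Top-z (inj₂ refl) x _ = prefer zyx z x
Top-z (inj₂ refl) y _ = prefer zyx z y
Top-z (inj₂ refl) z u≢z = ⊥-elim (u≢z refl)

Bot-z : ∀ {R} → Bot R → ∀ u → ¬ (z ≻[ R ] u)
Bot-z (inj₁ refl) x = ≻-asym {xyz} {x} {z} (prefer xyz x z)
Bot-z (inj₁ refl) y = ≻-asym {xyz} {y} {z} (prefer xyz y z)
Bot-z (inj₁ refl) z = ≻-irrefl {xyz} {z}
Bot-z (inj₂ refl) x = ≻-asym {yxz} {x} {z} (prefer yxz x z)
Bot-z (inj₂ refl) y = ≻-asym {yxz} {y} {z} (prefer yxz y z)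
Bot-z (inj₂ refl) z = ≻-irrefl {yxz} {z}

z-up-to-top : ∀ {R} S → Top S → ∀ u → z ≻[ R ] u → z ≻[ S ] u
z-up-to-top {R} S topS u z≻u = Top-z topS u (λ { refl → ≻-irrefl {R} {z} z≻u })

z-up-from-bottom : ∀ {R} S → Bot R → ∀ u → z ≻[ R ] u → z ≻[ S ] u
z-up-from-bottom S botR u z≻u = ⊥-elim (Bot-z botR u z≻u)

Bot-rev-Top : ∀ {R} → Bot R → Top (rev R)
Bot-rev-Top (inj₁ refl) = inj₂ refl
Bot-rev-Top (inj₂ refl) = inj₁ refl

xzy-only : ∀ R → x ≻[ R ] z → ¬ (y ≻[ R ] z) → R ≡ xzy
xzy-only xyz _ y⊁z = ⊥-elim (y⊁z (prefer xyz y z))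
xzy-only xzy _ _ = refl
xzy-only yxz _ y⊁z = ⊥-elim (y⊁z (prefer yxz y z))
xzy-only yzx x≻z _ = ⊥-elim (≻-asym {yzx} {x} {z} x≻z (prefer yzx z x))
xzy-only zxy x≻z _ = ⊥-elim (≻-asym {zxy} {x} {z} x≻z (prefer zxy z x))
xzy-only zyx x≻z _ = ⊥-elim (≻-asym {zyx} {x} {z} x≻z (prefer zyx z x))

yzx-only : ∀ R → y ≻[ R ] z → ¬ (x ≻[ R ] z) → R ≡ yzx
yzx-only xyz _ x⊁z = ⊥-elim (x⊁z (prefer xyz x z))
yzx-only xzy y≻z _ = ⊥-elim (≻-asym {xzy} {y} {z} y≻z (prefer xzy z y))
yzx-only yxz _ x⊁z = ⊥-elim (x⊁z (prefer yxz x z))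
yzx-only yzx _ _ = refl
yzx-only zxy y≻z _ = ⊥-elim (≻-asym {zxy} {y} {z} y≻z (prefer zxy z y))
yzx-only zyx y≻z _ = ⊥-elim (≻-asym {zyx} {y} {z} y≻z (prefer zyx z y))

xAboveY : L → Bool
xAboveY R = rank R x <ᵇ rank R y

xAboveY-rev : ∀ R → xAboveY (rev R) ≡ not (xAboveY R)
xAboveY-rev xyz = refl
xAboveY-rev xzy = refl
xAboveY-rev yxz = refl
xAboveY-rev yzx = refl
xAboveY-rev zxy = refl
xAboveY-rev zyx = refl

xAboveY-raiseZ : ∀ R → xAboveY (raiseZ R) ≡ xAboveY R
xAboveY-raiseZ xyz = refl
xAboveY-raiseZ xzy = refl
xAboveY-raiseZ yxz = refl
xAboveY-raiseZ yzx = refl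
xAboveY-raiseZ zxy = refl
xAboveY-raiseZ zyx = refl

x≻y⇒xAboveY : ∀ {R} → x ≻[ R ] y → xAboveY R ≡ true
x≻y⇒xAboveY x≻y = Equivalence.to T-≡ (<⇒<ᵇ x≻y)

xAboveY⇒x≻y : ∀ {R} → xAboveY R ≡ true → x ≻[ R ] y
xAboveY⇒x≻y {R} e = <ᵇ⇒< (rank R x) (rank R y) (Equivalence.from T-≡ e)

y≻x⇒¬xAboveY : ∀ {R} → y ≻[ R ] x → xAboveY R ≡ false
y≻x⇒¬xAboveY {R} y≻x with xAboveY R in e
... | true = ⊥-elim (≻-asym y≻x (xAboveY⇒x≻y e))
... | false = refl

¬xAboveY⇒y≻x : ∀ {R} → xAboveY R ≡ false → y ≻[ R ] x
¬xAboveY⇒y≻x {R} e with ≻-total R x y (λ ())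
... | inj₁ x≻y with () ← trans (sym e) (x≻y⇒xAboveY x≻y)
... | inj₂ y≻x = y≻x

SameXY : L → L → Set
SameXY R S = xAboveY R ≡ xAboveY S

sameXY-x : ∀ {R S} → SameXY R S → x ≻[ R ] y → x ≻[ S ] y
sameXY-x same x≻y = xAboveY⇒x≻y (trans (sym same) (x≻y⇒xAboveY x≻y))

sameXY-y : ∀ {R S} → SameXY R S → y ≻[ R ] x → y ≻[ S ] x
sameXY-y same y≻x = ¬xAboveY⇒y≻x (trans (sym same) (y≻x⇒¬xAboveY y≻x))

-- Two successive switches R → S (by two voters) lead from outcome w through μ to
-- w'.
two-switches : ∀ {R S} {w w' μ : X} → SameXY R S → ¬ (w ≡ z) → ¬ (w' ≡ z) →
               ¬ (μ ≻[ R ] w) → ¬ (w ≻[ S ] μ) → ¬ (w' ≻[ R ] μ) → ¬ (μ ≻[ S ] w') → w ≡ w'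
two-switches {R} {S} {w} {w'} {μ} same w≢z w'≢z c₁ c₂ c₃ c₄ = xy-equal w≢z w'≢z x-then-y y-then-x
  where
  x-then-y : w ≡ x → w' ≡ y → ⊥
  x-then-y refl refl with ≻-total R x y (λ ())
  ... | inj₁ x≻y with ≻-complement c₂
  ...   | inj₁ refl = c₄ (sameXY-x same x≻y)
  ...   | inj₂ μ≻x = c₄ (<-trans μ≻x (sameXY-x same x≻y))
  x-then-y refl refl | inj₂ y≻x with ≻-complement c₃
  ...   | inj₁ refl = c₁ y≻x
  ...   | inj₂ μ≻y = c₁ (<-trans μ≻y y≻x)
  y-then-x : w ≡ y → w' ≡ x → ⊥
  y-then-x refl refl with ≻-total R x y (λ ())
  ... | inj₂ y≻x with ≻-complement c₂
  ...   | inj₁ refl = c₄ (sameXY-y same y≻x)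
  ...   | inj₂ μ≻y = c₄ (<-trans μ≻y (sameXY-y same y≻x))
  y-then-x refl refl | inj₁ x≻y with ≻-complement c₃
  ...   | inj₁ refl = c₁ x≻y
  ...   | inj₂ μ≻x = c₁ (<-trans μ≻x x≻y)

opposite-top-x : ∀ {R} → x ≻[ R ] y → y ≻[ raiseZ (rev R) ] x
opposite-top-x {R} x≻y =
  ¬xAboveY⇒y≻x (trans (xAboveY-raiseZ (rev R)) (trans (xAboveY-rev R) (cong not (x≻y⇒xAboveY x≻y))))

opposite-top-y : ∀ {R} → y ≻[ R ] x → x ≻[ raiseZ (rev R) ] y
opposite-top-y {R} y≻x =
  xAboveY⇒x≻y (trans (xAboveY-raiseZ (rev R)) (trans (xAboveY-rev R) (cong not (y≻x⇒¬xAboveY y≻x))))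

module _ {n : ℕ} where

  infixl 5 _[_≔_]
  _[_≔_] : Profile n → Fin n → L → Profile n
  p [ h ≔ R ] = updateAt p h (const R)

  ≔-here : ∀ (p : Profile n) h {R} → (p [ h ≔ R ]) h ≡ R
  ≔-here p h = updateAt-updates h p

  ≔-other : ∀ (p : Profile n) {h i R} → ¬ (i ≡ h) → (p [ h ≔ R ]) i ≡ p i
  ≔-other p {h} {i} i≢h = updateAt-minimal i h p i≢h

  variant-sym : ∀ {h} {p q : Profile n} → Variant h p q → Variant h q p
  variant-sym v i i≢h = sym (v i i≢h)

  ≔-variant : ∀ {h R} (p : Profile n) → Variant h p (p [ h ≔ R ])
  ≔-variant p i i≢h = ≔-other p i≢h

  ≔-≔-variant : ∀ {h R R'} (p : Profile n) → Variant h (p [ h ≔ R ]) (p [ h ≔ R' ])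
  ≔-≔-variant p i i≢h = trans (≔-other p i≢h) (sym (≔-other p i≢h))

  variant-≔ : ∀ {h j R} {p q : Profile n} → Variant h p q → Variant h (p [ j ≔ R ]) (q [ j ≔ R ])
  variant-≔ {h} {j} {R} {p} {q} v i i≢h with i ≟F j
  ... | yes refl = trans (≔-here q i) (sym (≔-here p i))
  ... | no i≢j = trans (≔-other q i≢j) (trans (v i i≢h) (sym (≔-other p i≢j)))

  variant-same : ∀ {h} {p q : Profile n} → Variant h p q → p h ≡ q h → ∀ i → p i ≡ q i
  variant-same {h} v ph≡qh i with i ≟F h
  ... | yes refl = ph≡qh
  ... | no i≢h = sym (v i i≢h)

  anchors-or : ∀ {P : Fin n → Set} {p q : Profile n} (k a b : Fin n) →
               p k ≡ q k → p a ≡ q a → p b ≡ q b →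
               (∀ i → ¬ (i ≡ a) → ¬ (i ≡ b) → ¬ (i ≡ k) → (p i ≡ q i) ⊎ P i) →
               ∀ i → (p i ≡ q i) ⊎ P i
  anchors-or k a b ek ea eb rest i with i ≟F a | i ≟F b | i ≟F k
  ... | yes refl | _ | _ = inj₁ ea
  ... | no _ | yes refl | _ = inj₁ eb
  ... | no _ | no _ | yes refl = inj₁ ek
  ... | no i≢a | no i≢b | no i≢k = rest i i≢a i≢b i≢k

  OthersTop : Fin n → Fin n → Profile n → Set
  OthersTop a b q = ∀ i → ¬ (i ≡ a) → ¬ (i ≡ b) → Top (q i)

  Cov : Profile n → X → X → Set
  Cov p u v = Σ (Fin n) λ i → u ≻[ p i ] v

  cov-at : ∀ {p : Profile n} {u v} i {R} → p i ≡ R → u ≻[ R ] v → Cov p u v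
  cov-at {u = u} {v} i e u≻v = i , subst (λ S → u ≻[ S ] v) (sym e) u≻v

  mkNP : ∀ {p} → Cov p x y → Cov p y x → Cov p x z → Cov p z x → Cov p y z → Cov p z y → NP p
  mkNP _ _ _ _ _ _ x x x≢x = ⊥-elim (x≢x refl)
  mkNP _ _ _ _ _ _ y y y≢y = ⊥-elim (y≢y refl)
  mkNP _ _ _ _ _ _ z z z≢z = ⊥-elim (z≢z refl)
  mkNP (i , p) (j , q) _ _ _ _ x y _ = i , j , p , q
  mkNP (i , p) (j , q) _ _ _ _ y x _ = j , i , q , p
  mkNP _ _ (i , p) (j , q) _ _ x z _ = i , j , p , q
  mkNP _ _ (i , p) (j , q) _ _ z x _ = j , i , q , p
  mkNP _ _ _ _ (i , p) (j , q) y z _ = i , j , p , q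
  mkNP _ _ _ _ (i , p) (j , q) z y _ = j , i , q , p

  covNP : ∀ {p} → NP p → ∀ u v → ¬ (u ≡ v) → Cov p u v
  covNP np u v u≢v = proj₁ (np u v u≢v) , proj₁ (proj₂ (proj₂ (np u v u≢v)))

-- Three orderings K, A, B jointly contain both directions of every pair
-- (checked by computation); then any profile containing them is in NP.
above : L → X → X → Bool
above R u v = rank R u <ᵇ rank R v

someone : L → L → L → X → X → Bool
someone K A B u v = above K u v ∨ (above B u v ∨ above A u v)

Covering : L → L → L → Set
Covering K A B = T (someone K A B x y) × T (someone K A B y x) × T (someone K A B x z) ×
                 T (someone K A B z x) × T (someone K A B y z) × T (someone K A B z y)

covering-rev : ∀ K A → Covering K A (rev K)
covering-rev xyz _ = _
covering-rev xzy _ = _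
covering-rev yxz _ = _
covering-rev yzx _ = _
covering-rev zxy _ = _
covering-rev zyx _ = _

module _ {n : ℕ} where

  covering-NP : ∀ {p : Profile n} (k a b : Fin n) {K A B} → p k ≡ K → p a ≡ A → p b ≡ B →
                Covering K A B → NP p
  covering-NP {p} k a b {K} {A} {B} ek ea eb (t₁ , t₂ , t₃ , t₄ , t₅ , t₆) =
      mkNP (cov x y t₁) (cov y x t₂) (cov x z t₃) (cov z x t₄) (cov y z t₅) (cov z y t₆)
    where
    cov : ∀ u v → T (someone K A B u v) → Cov p u v
    cov u v s with Equivalence.to T-∨ s
    ... | inj₁ sK = cov-at k ek (<ᵇ⇒< (rank K u) (rank K v) sK)
    ... | inj₂ s' with Equivalence.to T-∨ s'
    ...   | inj₁ sB = cov-at b eb (<ᵇ⇒< (rank B u) (rank B v) sB)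
    ...   | inj₂ sA = cov-at a ea (<ᵇ⇒< (rank A u) (rank A v) sA)

  -- mix j p q: voters with index below j vote as in q, the others as in p.
  -- Walking j from 0 to n turns p into q one voter at a time.
  mix : ℕ → Profile n → Profile n → Profile n
  mix j p q i with toℕ i ℕP.<? j
  ... | yes _ = q i
  ... | no _ = p i

  Mixture : Profile n → Profile n → Profile n → Set
  Mixture p q r = ∀ i → (r i ≡ p i) ⊎ (r i ≡ q i)

  mix-mixture : ∀ j p q → Mixture p q (mix j p q)
  mix-mixture j p q i with toℕ i ℕP.<? j
  ... | yes _ = inj₂ refl
  ... | no _ = inj₁ refl

  mixture-agree : ∀ {p q r i R} → Mixture p q r → p i ≡ R → q i ≡ R → r i ≡ R
  mixture-agree {i = i} m pi≡R qi≡R with m i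
  ... | inj₁ e = trans e pi≡R
  ... | inj₂ e = trans e qi≡R

  mix-below : ∀ {j p q} i → toℕ i ℕ.< j → mix j p q i ≡ q i
  mix-below {j} i lt with toℕ i ℕP.<? j
  ... | yes _ = refl
  ... | no nlt = ⊥-elim (nlt lt)

  mix-above : ∀ {j p q} i → ¬ (toℕ i ℕ.< j) → mix j p q i ≡ p i
  mix-above {j} i nlt with toℕ i ℕP.<? j
  ... | yes lt = ⊥-elim (nlt lt)
  ... | no _ = refl

  mix-step : ∀ {j} p q (j<n : j ℕ.< n) → Variant (fromℕ< j<n) (mix j p q) (mix (suc j) p q)
  mix-step {j} p q j<n i i≢h with toℕ i ℕP.<? j
  ... | yes lt = mix-below i (m<n⇒m<1+n lt)
  ... | no nlt with toℕ i ℕP.<? suc j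
  ...   | no _ = refl
  ...   | yes lt with m<1+n⇒m<n∨m≡n lt
  ...     | inj₁ lt' = ⊥-elim (nlt lt')
  ...     | inj₂ i≡j = ⊥-elim (i≢h (toℕ-injective (trans i≡j (sym (toℕ-fromℕ< j<n)))))

module Strategyproof {n : ℕ} (g : Rule n) (sp : StrategyProof g) where

  g-ext : ∀ {p q} (np : NP p) (nq : NP q) → (∀ i → p i ≡ q i) → g p np ≡ g q nq
  g-ext {p} {q} np nq p≗q with g p np ≟X g q nq
  ... | yes same = same
  ... | no differ with np (g q nq) (g p np) (differ ∘ sym)
  ...   | i , _ , q-better , _ = ⊥-elim (sp i p q np nq (λ k _ → sym (p≗q k)) q-better)

  no-gain : ∀ {h q q'} {nq : NP q} {nq' : NP q'} {u v : X} → Variant h q q' →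
            g q nq ≡ u → g q' nq' ≡ v → ¬ (v ≻[ q h ] u)
  no-gain {h} {q} {q'} {nq} {nq'} var refl refl = sp h q q' nq nq' var

  mono : ∀ {h q q'} {nq : NP q} {nq' : NP q'} {w : X} → Variant h q q' →
         g q nq ≡ w → (∀ u → w ≻[ q h ] u → w ≻[ q' h ] u) → g q' nq' ≡ w
  mono {h} {q} {q'} {nq} {nq'} {w} var win keep with g q' nq' ≟X w
  ... | yes win' = win'
  ... | no lose with ≻-total (q h) w (g q' nq') (lose ∘ sym)
  ...   | inj₁ w≻v = ⊥-elim (no-gain {nq = nq'} {nq' = nq} (variant-sym var) refl win (keep _ w≻v))
  ...   | inj₂ v≻w = ⊥-elim (no-gain {nq = nq} {nq' = nq'} var win refl v≻w)

  mono-top : ∀ {h q q'} {nq : NP q} {nq' : NP q'} {w : X} → Variant h q q' →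
             g q nq ≡ w → (∀ u → ¬ (u ≡ w) → w ≻[ q' h ] u) → g q' nq' ≡ w
  mono-top {h} {q} var win top = mono var win (λ u w≻u → top u (λ { refl → ≻-irrefl {q h} w≻u }))

  last-stays : ∀ {h q q'} {nq : NP q} {nq' : NP q'} {w : X} → Variant h q q' →
               g q nq ≡ w → (∀ u → ¬ (u ≡ w) → u ≻[ q h ] w) → g q' nq' ≡ w
  last-stays {h} {q} {q'} {nq} {nq'} {w} var win last with g q' nq' ≟X w
  ... | yes win' = win'
  ... | no lose = ⊥-elim (no-gain {nq = nq} {nq' = nq'} var win refl (last _ lose))

  xy-stays : ∀ {h r r'} {nr : NP r} {nr' : NP r'} → Variant h r r' → SameXY (r h) (r' h) →
             ¬ (g r nr ≡ z) → ¬ (g r' nr' ≡ z) → g r nr ≡ g r' nr'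
  xy-stays {h} {r} {r'} {nr} {nr'} var same r≢z r'≢z = xy-equal r≢z r'≢z x-then-y y-then-x
    where
    x-then-y : g r nr ≡ x → g r' nr' ≡ y → ⊥
    x-then-y ex ey with ≻-total (r h) x y (λ ())
    ... | inj₁ x≻y = no-gain {nq = nr'} {nq' = nr} (variant-sym var) ey ex (sameXY-x same x≻y)
    ... | inj₂ y≻x = no-gain {nq = nr} {nq' = nr'} var ex ey y≻x
    y-then-x : g r nr ≡ y → g r' nr' ≡ x → ⊥
    y-then-x ey ex with ≻-total (r h) x y (λ ())
    ... | inj₁ x≻y = no-gain {nq = nr} {nq' = nr'} var ey ex x≻y
    ... | inj₂ y≻x = no-gain {nq = nr'} {nq' = nr} (variant-sym var) ex ey (sameXY-y same y≻x)

  Step : Profile n → Profile n → X → Set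
  Step p q w = ∀ h r r' (nr : NP r) (nr' : NP r') → Variant h r r' → r h ≡ p h → r' h ≡ q h →
               Mixture p q r → Mixture p q r' → g r nr ≡ w → g r' nr' ≡ w

  walk : ∀ (p q : Profile n) {w : X} → (∀ j → NP (mix j p q)) → Step p q w →
         (np : NP p) (nq : NP q) → g p np ≡ w → g q nq ≡ w
  walk p q {w} mnp step np nq win =
      trans (sym (g-ext (mnp n) nq (λ i → mix-below i (toℕ<n i)))) (go n)
    where
    go : ∀ j → g (mix j p q) (mnp j) ≡ w
    go zero = trans (g-ext (mnp 0) np (λ i → mix-above {j = 0} {p} {q} i (λ ()))) win
    go (suc j) with j ℕP.<? n
    ... | no j≮n = trans (g-ext (mnp (suc j)) (mnp j) unchanged) (go j)
      where
      unchanged : ∀ i → mix (suc j) p q i ≡ mix j p q i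
      unchanged i = trans (mix-below i (m<n⇒m<1+n i<j)) (sym (mix-below i i<j))
        where
        i<j : toℕ i ℕ.< j
        i<j = ℕP.<-≤-trans (toℕ<n i) (≮⇒≥ j≮n)
    ... | yes j<n = step h _ _ (mnp j) (mnp (suc j)) (mix-step p q j<n)
                      (mix-above h (<-irrefl (toℕ-fromℕ< j<n)))
                      (mix-below h (subst (ℕ._< suc j) (sym (toℕ-fromℕ< j<n)) (ℕP.n<1+n j)))
                      (mix-mixture j p q) (mix-mixture (suc j) p q) (go j)
      where
      h : Fin n
      h = fromℕ< j<n

  -- walk, when three voters k, a, b have the same covering orderings in p and q
  -- (so every mixture is in NP).
  walk-anchored : ∀ (p q : Profile n) (k a b : Fin n) {K A B} {w : X} →
                  p k ≡ K → q k ≡ K → p a ≡ A → q a ≡ A → p b ≡ B → q b ≡ B → Covering K A B →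
                  Step p q w → (np : NP p) (nq : NP q) → g p np ≡ w → g q nq ≡ w
  walk-anchored p q k a b pk qk pa qa pb qb cov =
    walk p q (λ j → covering-NP k a b (anchor j pk qk) (anchor j pa qa) (anchor j pb qb) cov)
    where
    anchor : ∀ j {i R} → p i ≡ R → q i ≡ R → mix j p q i ≡ R
    anchor j = mixture-agree (mix-mixture j p q)

  step-raise-z : ∀ {p q} → (∀ i → (p i ≡ q i) ⊎ Top (q i)) → Step p q z
  step-raise-z {p} {q} move h r r' nr nr' var rh r'h _ _ win with move h
  ... | inj₁ same = trans (sym (g-ext nr nr' (variant-same var (trans rh (trans same (sym r'h)))))) win
  ... | inj₂ top = mono-top var win (λ u u≢z → subst (λ S → z ≻[ S ] u) (sym r'h) (Top-z top u u≢z))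

  step-from-last : ∀ {p q} (w : X) → (∀ i → (p i ≡ q i) ⊎ (∀ u → ¬ (u ≡ w) → u ≻[ p i ] w)) →
                   Step p q w
  step-from-last {p} {q} w move h r r' nr nr' var rh r'h _ _ win with move h
  ... | inj₁ same = trans (sym (g-ext nr nr' (variant-same var (trans rh (trans same (sym r'h)))))) win
  ... | inj₂ last = last-stays var win (λ u u≢w → subst (λ S → u ≻[ S ] w) (sym rh) (last u u≢w))

  step-same-xy : ∀ {p q} (w : X) → (∀ i → (p i ≡ q i) ⊎ SameXY (p i) (q i)) →
                 (∀ r nr → Mixture p q r → ¬ (g r nr ≡ z)) → Step p q w
  step-same-xy {p} {q} w move no-z h r r' nr nr' var rh r'h mr mr' win with move h
  ... | inj₁ same = trans (sym (g-ext nr nr' (variant-same var (trans rh (trans same (sym r'h)))))) win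
  ... | inj₂ same =
    trans (sym (xy-stays var (subst₂ SameXY (sym rh) (sym r'h) same) (no-z r nr mr) (no-z r' nr' mr'))) win

  keep-z : ∀ p (np : NP p) h R (np' : NP (p [ h ≔ R ])) → g p np ≡ z →
           (∀ u → z ≻[ p h ] u → z ≻[ R ] u) → g (p [ h ≔ R ]) np' ≡ z
  keep-z p np h R np' win keep =
    mono (≔-variant p) win (λ u z≻u → subst (λ S → z ≻[ S ] u) (sym (≔-here p h)) (keep u z≻u))

  ZAnchored : Fin n → Fin n → Set
  ZAnchored a b = Σ (Profile n) λ q → Σ (NP q) λ nq →
                  (g q nq ≡ z) × Bot (q a) × Top (q b) × OthersTop a b q

-- H K A B is the outcome
-- when k, a, b report K, A, B and everybody else reports as in bg.
module Table {n : ℕ} (g : Rule n) (sp : StrategyProof g)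
             (a b : Fin n) (a≢b : ¬ (a ≡ b)) (agree⇒¬z : ∀ p np → p a ≡ p b → ¬ (g p np ≡ z))
             (k : Fin n) (k≢a : ¬ (k ≡ a)) (k≢b : ¬ (k ≡ b)) (bg : Profile n) where

  open Strategyproof g sp

  emb : L → L → L → Profile n
  emb K A B = bg [ k ≔ K ] [ b ≔ B ] [ a ≔ A ]

  emb-a : ∀ {K A B} → emb K A B a ≡ A
  emb-a = ≔-here _ a

  emb-b : ∀ {K A B} → emb K A B b ≡ B
  emb-b = trans (≔-other _ (a≢b ∘ sym)) (≔-here _ b)

  emb-k : ∀ {K A B} → emb K A B k ≡ K
  emb-k = trans (≔-other _ k≢a) (trans (≔-other _ k≢b) (≔-here bg k))

  emb-other : ∀ {K A B} i → ¬ (i ≡ a) → ¬ (i ≡ b) → ¬ (i ≡ k) → emb K A B i ≡ bg i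
  emb-other i i≢a i≢b i≢k = trans (≔-other _ i≢a) (trans (≔-other _ i≢b) (≔-other bg i≢k))

  emb-NP : ∀ {K A B} → Covering K A B → NP (emb K A B)
  emb-NP = covering-NP k a b emb-k emb-a emb-b

  H : (K A B : L) → {Covering K A B} → X
  H K A B {cov} = g (emb K A B) (emb-NP cov)

  variant-k : ∀ {K K' A B} → Variant k (emb K A B) (emb K' A B)
  variant-k = variant-≔ (variant-≔ (≔-≔-variant bg))

  variant-a : ∀ {K A A' B} → Variant a (emb K A B) (emb K A' B)
  variant-a = ≔-≔-variant _

  variant-b : ∀ {K A B B'} → Variant b (emb K A B) (emb K A B')
  variant-b = variant-≔ (≔-≔-variant _)

  sp-k : ∀ {K K' A B} {t : Covering K A B} {t' : Covering K' A B} {u v} →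
         H K A B {t} ≡ u → H K' A B {t'} ≡ v → ¬ (v ≻[ K ] u)
  sp-k {K} {u = u} {v} e e' v≻u =
    no-gain variant-k e e' (subst (λ S → v ≻[ S ] u) (sym emb-k) v≻u)

  sp-a : ∀ {K A A' B} {t : Covering K A B} {t' : Covering K A' B} {u v} →
         H K A B {t} ≡ u → H K A' B {t'} ≡ v → ¬ (v ≻[ A ] u)
  sp-a {u = u} {v} e e' v≻u =
    no-gain variant-a e e' (subst (λ S → v ≻[ S ] u) (sym emb-a) v≻u)

  sp-b : ∀ {K A B B'} {t : Covering K A B} {t' : Covering K A B'} {u v} →
         H K A B {t} ≡ u → H K A B' {t'} ≡ v → ¬ (v ≻[ B ] u)
  sp-b {u = u} {v} e e' v≻u =
    no-gain variant-b e e' (subst (λ S → v ≻[ S ] u) (sym emb-b) v≻u)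

  diag≢z : ∀ {K A} {t : Covering K A A} → ¬ (H K A A {t} ≡ z)
  diag≢z {t = t} = agree⇒¬z _ (emb-NP t) (trans emb-a (sym emb-b))

  emb-≗ : ∀ {K A B} {p : Profile n} → p k ≡ K → p a ≡ A → p b ≡ B →
          (∀ i → ¬ (i ≡ a) → ¬ (i ≡ b) → ¬ (i ≡ k) → bg i ≡ p i) → ∀ i → emb K A B i ≡ p i
  emb-≗ {K} {A} {B} {p} pk pa pb rest =
    reduce ∘ anchors-or {P = λ j → emb K A B j ≡ p j} {emb K A B} {p} k a b
                      (trans emb-k (sym pk)) (trans emb-a (sym pa)) (trans emb-b (sym pb))
                      (λ j j≢a j≢b j≢k → inj₁ (trans (emb-other j j≢a j≢b j≢k) (rest j j≢a j≢b j≢k)))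

  H-≡-g : ∀ {K A B} {t : Covering K A B} {p} (np : NP p) → (∀ i → emb K A B i ≡ p i) → H K A B {t} ≡ g p np
  H-≡-g {t = t} np = g-ext (emb-NP t) np

  -- A fact
  -- `K,A,B↦u` says H K A B ≡ u; `K,A,B↛u` excludes u, because one of the three
  -- voters, moving between this entry and a known one, would otherwise gain.
  -- Two exclusions (or the a = b rule diag≢z) determine an entry.

  -- If k and a rank z last and b ranks it first, z loses: otherwise a could
  -- copy b, where z must still win (a ranks z last) but cannot (a = b).
  z-loses-xyz-xyz-zyx : H xyz xyz zyx ≡ z → ⊥
  z-loses-xyz-xyz-zyx xyz,xyz,zyx↦z = diag≢z xyz,zyx,zyx↦z
    where
    xyz,zyx,zyx↛x : H xyz zyx zyx ≡ x → ⊥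
    xyz,zyx,zyx↛x = λ e → sp-a xyz,xyz,zyx↦z e (prefer xyz x z)
    xyz,zyx,zyx↛y : H xyz zyx zyx ≡ y → ⊥
    xyz,zyx,zyx↛y = λ e → sp-a xyz,xyz,zyx↦z e (prefer xyz y z)
    xyz,zyx,zyx↦z : H xyz zyx zyx ≡ z
    xyz,zyx,zyx↦z = isZ xyz,zyx,zyx↛x xyz,zyx,zyx↛y

  raise-xyz-xy : H xyz zyx zyx ≡ x → H zxy yxz yxz ≡ y → ⊥
  raise-xyz-xy xyz,zyx,zyx↦x zxy,yxz,yxz↦y = sp-b xzy,yxz,zyx↦x xzy,yxz,yzx↦y (prefer zyx y x)
    where
    xyz,yxz,zyx↛y : H xyz yxz zyx ≡ y → ⊥
    xyz,yxz,zyx↛y = λ e → sp-a xyz,zyx,zyx↦x e (prefer zyx y x)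
    xyz,yxz,zyx↛z : H xyz yxz zyx ≡ z → ⊥
    xyz,yxz,zyx↛z = λ e → sp-a e xyz,zyx,zyx↦x (prefer yxz x z)
    xyz,yxz,zyx↦x : H xyz yxz zyx ≡ x
    xyz,yxz,zyx↦x = isX xyz,yxz,zyx↛y xyz,yxz,zyx↛z
    xzy,yxz,zyx↛y : H xzy yxz zyx ≡ y → ⊥
    xzy,yxz,zyx↛y = λ e → sp-k e xyz,yxz,zyx↦x (prefer xzy x y)
    xzy,yxz,zyx↛z : H xzy yxz zyx ≡ z → ⊥
    xzy,yxz,zyx↛z = λ e → sp-k e xyz,yxz,zyx↦x (prefer xzy x z)
    xzy,yxz,zyx↦x : H xzy yxz zyx ≡ x
    xzy,yxz,zyx↦x = isX xzy,yxz,zyx↛y xzy,yxz,zyx↛z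
    zxy,yxz,yzx↛x : H zxy yxz yzx ≡ x → ⊥
    zxy,yxz,yzx↛x = λ e → sp-b e zxy,yxz,yxz↦y (prefer yzx y x)
    zxy,yxz,yzx↛z : H zxy yxz yzx ≡ z → ⊥
    zxy,yxz,yzx↛z = λ e → sp-b e zxy,yxz,yxz↦y (prefer yzx y z)
    zxy,yxz,yzx↦y : H zxy yxz yzx ≡ y
    zxy,yxz,yzx↦y = isY zxy,yxz,yzx↛x zxy,yxz,yzx↛z
    xzy,yxz,yzx↛x : H xzy yxz yzx ≡ x → ⊥
    xzy,yxz,yzx↛x = λ e → sp-k zxy,yxz,yzx↦y e (prefer zxy x y)
    xzy,yxz,yzx↛z : H xzy yxz yzx ≡ z → ⊥
    xzy,yxz,yzx↛z = λ e → sp-k zxy,yxz,yzx↦y e (prefer zxy z y)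
    xzy,yxz,yzx↦y : H xzy yxz yzx ≡ y
    xzy,yxz,yzx↦y = isY xzy,yxz,yzx↛x xzy,yxz,yzx↛z

  raise-xyz-yx : H xyz zyx zyx ≡ y → H zxy yxz yxz ≡ x → ⊥
  raise-xyz-yx xyz,zyx,zyx↦y zxy,yxz,yxz↦x = xzy,yzx,yzx↛x (isX xzy,yzx,yzx↛y xzy,yzx,yzx↛z)
    where
    xyz,zyx,yzx↛x : H xyz zyx yzx ≡ x → ⊥
    xyz,zyx,yzx↛x = λ e → sp-b e xyz,zyx,zyx↦y (prefer yzx y x)
    xyz,zyx,yzx↛z : H xyz zyx yzx ≡ z → ⊥
    xyz,zyx,yzx↛z = λ e → sp-b e xyz,zyx,zyx↦y (prefer yzx y z)
    xyz,zyx,yzx↦y : H xyz zyx yzx ≡ y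
    xyz,zyx,yzx↦y = isY xyz,zyx,yzx↛x xyz,zyx,yzx↛z
    xzy,zyx,yzx↛x : H xzy zyx yzx ≡ x → ⊥
    xzy,zyx,yzx↛x = λ e → sp-k xyz,zyx,yzx↦y e (prefer xyz x y)
    xyz,zyx,yxz↛x : H xyz zyx yxz ≡ x → ⊥
    xyz,zyx,yxz↛x = λ e → sp-b e xyz,zyx,zyx↦y (prefer yxz y x)
    xyz,zyx,yxz↛z : H xyz zyx yxz ≡ z → ⊥
    xyz,zyx,yxz↛z = λ e → sp-b e xyz,zyx,zyx↦y (prefer yxz y z)
    xyz,zyx,yxz↦y : H xyz zyx yxz ≡ y
    xyz,zyx,yxz↦y = isY xyz,zyx,yxz↛x xyz,zyx,yxz↛z
    xzy,zyx,yxz↛x : H xzy zyx yxz ≡ x → ⊥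
    xzy,zyx,yxz↛x = λ e → sp-k xyz,zyx,yxz↦y e (prefer xyz x y)
    zxy,zyx,yxz↛x : H zxy zyx yxz ≡ x → ⊥
    zxy,zyx,yxz↛x = λ e → sp-k xyz,zyx,yxz↦y e (prefer xyz x y)
    zxy,zyx,yxz↛y : H zxy zyx yxz ≡ y → ⊥
    zxy,zyx,yxz↛y = λ e → sp-a zxy,yxz,yxz↦x e (prefer yxz y x)
    zxy,zyx,yxz↦z : H zxy zyx yxz ≡ z
    zxy,zyx,yxz↦z = isZ zxy,zyx,yxz↛x zxy,zyx,yxz↛y
    xzy,zyx,yxz↛y : H xzy zyx yxz ≡ y → ⊥
    xzy,zyx,yxz↛y = λ e → sp-k e zxy,zyx,yxz↦z (prefer xzy z y)
    xzy,zyx,yxz↦z : H xzy zyx yxz ≡ z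
    xzy,zyx,yxz↦z = isZ xzy,zyx,yxz↛x xzy,zyx,yxz↛y
    xzy,zyx,yzx↛y : H xzy zyx yzx ≡ y → ⊥
    xzy,zyx,yzx↛y = λ e → sp-b xzy,zyx,yxz↦z e (prefer yxz y z)
    xzy,zyx,yzx↦z : H xzy zyx yzx ≡ z
    xzy,zyx,yzx↦z = isZ xzy,zyx,yzx↛x xzy,zyx,yzx↛y
    xzy,yzx,yzx↛x : H xzy yzx yzx ≡ x → ⊥
    xzy,yzx,yzx↛x = λ e → sp-a e xzy,zyx,yzx↦z (prefer yzx z x)
    xyz,yxz,zyx↛x : H xyz yxz zyx ≡ x → ⊥
    xyz,yxz,zyx↛x = λ e → sp-a e xyz,zyx,zyx↦y (prefer yxz y x)
    xyz,yxz,zyx↛z : H xyz yxz zyx ≡ z → ⊥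
    xyz,yxz,zyx↛z = λ e → sp-a e xyz,zyx,zyx↦y (prefer yxz y z)
    xyz,yxz,zyx↦y : H xyz yxz zyx ≡ y
    xyz,yxz,zyx↦y = isY xyz,yxz,zyx↛x xyz,yxz,zyx↛z
    xzy,yxz,zyx↛x : H xzy yxz zyx ≡ x → ⊥
    xzy,yxz,zyx↛x = λ e → sp-k xyz,yxz,zyx↦y e (prefer xyz x y)
    zxy,yxz,zyx↛x : H zxy yxz zyx ≡ x → ⊥
    zxy,yxz,zyx↛x = λ e → sp-k xyz,yxz,zyx↦y e (prefer xyz x y)
    zxy,yxz,zyx↛y : H zxy yxz zyx ≡ y → ⊥
    zxy,yxz,zyx↛y = λ e → sp-b zxy,yxz,yxz↦x e (prefer yxz y x)
    zxy,yxz,zyx↦z : H zxy yxz zyx ≡ z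
    zxy,yxz,zyx↦z = isZ zxy,yxz,zyx↛x zxy,yxz,zyx↛y
    xzy,yxz,zyx↛y : H xzy yxz zyx ≡ y → ⊥
    xzy,yxz,zyx↛y = λ e → sp-k e zxy,yxz,zyx↦z (prefer xzy z y)
    xzy,yxz,zyx↦z : H xzy yxz zyx ≡ z
    xzy,yxz,zyx↦z = isZ xzy,yxz,zyx↛x xzy,yxz,zyx↛y
    xzy,yxz,yzx↛x : H xzy yxz yzx ≡ x → ⊥
    xzy,yxz,yzx↛x = λ e → sp-b e xzy,yxz,zyx↦z (prefer yzx z x)
    zxy,yxz,yzx↛x : H zxy yxz yzx ≡ x → ⊥
    zxy,yxz,yzx↛x = λ e → sp-b e zxy,yxz,zyx↦z (prefer yzx z x)
    zxy,yxz,yzx↛y : H zxy yxz yzx ≡ y → ⊥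
    zxy,yxz,yzx↛y = λ e → sp-b zxy,yxz,yxz↦x e (prefer yxz y x)
    zxy,yxz,yzx↦z : H zxy yxz yzx ≡ z
    zxy,yxz,yzx↦z = isZ zxy,yxz,yzx↛x zxy,yxz,yzx↛y
    xzy,yxz,yzx↛y : H xzy yxz yzx ≡ y → ⊥
    xzy,yxz,yzx↛y = λ e → sp-k e zxy,yxz,yzx↦z (prefer xzy z y)
    xzy,yxz,yzx↦z : H xzy yxz yzx ≡ z
    xzy,yxz,yzx↦z = isZ xzy,yxz,yzx↛x xzy,yxz,yzx↛y
    xzy,yzx,yzx↛y : H xzy yzx yzx ≡ y → ⊥
    xzy,yzx,yzx↛y = λ e → sp-a xzy,yxz,yzx↦z e (prefer yxz y z)
    xzy,yzx,yzx↛z : H xzy yzx yzx ≡ z → ⊥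
    xzy,yzx,yzx↛z = diag≢z

  raise-xyz : H xyz zyx zyx ≡ H zxy yxz yxz
  raise-xyz = xy-equal diag≢z diag≢z raise-xyz-xy raise-xyz-yx
  raise-xzy-xy : H xzy yzx yzx ≡ x → H zxy yxz yxz ≡ y → ⊥
  raise-xzy-xy xzy,yzx,yzx↦x zxy,yxz,yxz↦y = sp-k zxy,yxz,yzx↦y xzy,yxz,yzx↦x (prefer zxy x y)
    where
    zxy,yxz,yzx↛x : H zxy yxz yzx ≡ x → ⊥
    zxy,yxz,yzx↛x = λ e → sp-b e zxy,yxz,yxz↦y (prefer yzx y x)
    zxy,yxz,yzx↛z : H zxy yxz yzx ≡ z → ⊥
    zxy,yxz,yzx↛z = λ e → sp-b e zxy,yxz,yxz↦y (prefer yzx y z)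
    zxy,yxz,yzx↦y : H zxy yxz yzx ≡ y
    zxy,yxz,yzx↦y = isY zxy,yxz,yzx↛x zxy,yxz,yzx↛z
    xzy,yxz,yzx↛y : H xzy yxz yzx ≡ y → ⊥
    xzy,yxz,yzx↛y = λ e → sp-a xzy,yzx,yzx↦x e (prefer yzx y x)
    xzy,yxz,yzx↛z : H xzy yxz yzx ≡ z → ⊥
    xzy,yxz,yzx↛z = λ e → sp-a e xzy,yzx,yzx↦x (prefer yxz x z)
    xzy,yxz,yzx↦x : H xzy yxz yzx ≡ x
    xzy,yxz,yzx↦x = isX xzy,yxz,yzx↛y xzy,yxz,yzx↛z

  raise-xzy-yx : H xzy yzx yzx ≡ y → H zxy yxz yxz ≡ x → ⊥
  raise-xzy-yx xzy,yzx,yzx↦y zxy,yxz,yxz↦x = zxy,yxz,yzx↛x (isX zxy,yxz,yzx↛y zxy,yxz,yzx↛z)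
    where
    xzy,yxz,yzx↛x : H xzy yxz yzx ≡ x → ⊥
    xzy,yxz,yzx↛x = λ e → sp-a e xzy,yzx,yzx↦y (prefer yxz y x)
    xzy,yxz,yzx↛z : H xzy yxz yzx ≡ z → ⊥
    xzy,yxz,yzx↛z = λ e → sp-a e xzy,yzx,yzx↦y (prefer yxz y z)
    xzy,yxz,yzx↦y : H xzy yxz yzx ≡ y
    xzy,yxz,yzx↦y = isY xzy,yxz,yzx↛x xzy,yxz,yzx↛z
    zxy,yxz,yzx↛x : H zxy yxz yzx ≡ x → ⊥
    zxy,yxz,yzx↛x = λ e → sp-k xzy,yxz,yzx↦y e (prefer xzy x y)
    zxy,yxz,yzx↛y : H zxy yxz yzx ≡ y → ⊥
    zxy,yxz,yzx↛y = λ e → sp-b zxy,yxz,yxz↦x e (prefer yxz y x)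
    zxy,yxz,yzx↛z : H zxy yxz yzx ≡ z → ⊥
    zxy,yxz,yzx↛z = λ e → sp-k xzy,yxz,yzx↦y e (prefer xzy z y)

  raise-xzy : H xzy yzx yzx ≡ H zxy yxz yxz
  raise-xzy = xy-equal diag≢z diag≢z raise-xzy-xy raise-xzy-yx
  raise-yxz-xy : H yxz zxy zxy ≡ x → H zyx xyz xyz ≡ y → ⊥
  raise-yxz-xy yxz,zxy,zxy↦x zyx,xyz,xyz↦y = yzx,xzy,xzy↛x (isX yzx,xzy,xzy↛y yzx,xzy,xzy↛z)
    where
    zyx,xyz,xzy↛x : H zyx xyz xzy ≡ x → ⊥
    zyx,xyz,xzy↛x = λ e → sp-b zyx,xyz,xyz↦y e (prefer xyz x y)
    zyx,xyz,zxy↛x : H zyx xyz zxy ≡ x → ⊥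
    zyx,xyz,zxy↛x = λ e → sp-b zyx,xyz,xyz↦y e (prefer xyz x y)
    yxz,xyz,zxy↛y : H yxz xyz zxy ≡ y → ⊥
    yxz,xyz,zxy↛y = λ e → sp-a e yxz,zxy,zxy↦x (prefer xyz x y)
    yxz,xyz,zxy↛z : H yxz xyz zxy ≡ z → ⊥
    yxz,xyz,zxy↛z = λ e → sp-a e yxz,zxy,zxy↦x (prefer xyz x z)
    yxz,xyz,zxy↦x : H yxz xyz zxy ≡ x
    yxz,xyz,zxy↦x = isX yxz,xyz,zxy↛y yxz,xyz,zxy↛z
    zyx,xyz,zxy↛y : H zyx xyz zxy ≡ y → ⊥
    zyx,xyz,zxy↛y = λ e → sp-k yxz,xyz,zxy↦x e (prefer yxz y x)
    zyx,xyz,zxy↦z : H zyx xyz zxy ≡ z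
    zyx,xyz,zxy↦z = isZ zyx,xyz,zxy↛x zyx,xyz,zxy↛y
    zyx,xyz,xzy↛y : H zyx xyz xzy ≡ y → ⊥
    zyx,xyz,xzy↛y = λ e → sp-b e zyx,xyz,zxy↦z (prefer xzy z y)
    zyx,xyz,xzy↦z : H zyx xyz xzy ≡ z
    zyx,xyz,xzy↦z = isZ zyx,xyz,xzy↛x zyx,xyz,xzy↛y
    yzx,xyz,xzy↛x : H yzx xyz xzy ≡ x → ⊥
    yzx,xyz,xzy↛x = λ e → sp-k e zyx,xyz,xzy↦z (prefer yzx z x)
    yzx,xyz,zxy↛x : H yzx xyz zxy ≡ x → ⊥
    yzx,xyz,zxy↛x = λ e → sp-k e zyx,xyz,zxy↦z (prefer yzx z x)
    yzx,xyz,zxy↛y : H yzx xyz zxy ≡ y → ⊥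
    yzx,xyz,zxy↛y = λ e → sp-k yxz,xyz,zxy↦x e (prefer yxz y x)
    yzx,xyz,zxy↦z : H yzx xyz zxy ≡ z
    yzx,xyz,zxy↦z = isZ yzx,xyz,zxy↛x yzx,xyz,zxy↛y
    yzx,xyz,xzy↛y : H yzx xyz xzy ≡ y → ⊥
    yzx,xyz,xzy↛y = λ e → sp-b e yzx,xyz,zxy↦z (prefer xzy z y)
    yzx,xyz,xzy↦z : H yzx xyz xzy ≡ z
    yzx,xyz,xzy↦z = isZ yzx,xyz,xzy↛x yzx,xyz,xzy↛y
    yzx,xzy,xzy↛x : H yzx xzy xzy ≡ x → ⊥
    yzx,xzy,xzy↛x = λ e → sp-a yzx,xyz,xzy↦z e (prefer xyz x z)
    zyx,zxy,xyz↛x : H zyx zxy xyz ≡ x → ⊥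
    zyx,zxy,xyz↛x = λ e → sp-a zyx,xyz,xyz↦y e (prefer xyz x y)
    yxz,zxy,xyz↛y : H yxz zxy xyz ≡ y → ⊥
    yxz,zxy,xyz↛y = λ e → sp-b e yxz,zxy,zxy↦x (prefer xyz x y)
    yxz,zxy,xyz↛z : H yxz zxy xyz ≡ z → ⊥
    yxz,zxy,xyz↛z = λ e → sp-b e yxz,zxy,zxy↦x (prefer xyz x z)
    yxz,zxy,xyz↦x : H yxz zxy xyz ≡ x
    yxz,zxy,xyz↦x = isX yxz,zxy,xyz↛y yxz,zxy,xyz↛z
    zyx,zxy,xyz↛y : H zyx zxy xyz ≡ y → ⊥
    zyx,zxy,xyz↛y = λ e → sp-k yxz,zxy,xyz↦x e (prefer yxz y x)
    zyx,zxy,xyz↦z : H zyx zxy xyz ≡ z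
    zyx,zxy,xyz↦z = isZ zyx,zxy,xyz↛x zyx,zxy,xyz↛y
    yzx,zxy,xyz↛x : H yzx zxy xyz ≡ x → ⊥
    yzx,zxy,xyz↛x = λ e → sp-k e zyx,zxy,xyz↦z (prefer yzx z x)
    yzx,zxy,xyz↛y : H yzx zxy xyz ≡ y → ⊥
    yzx,zxy,xyz↛y = λ e → sp-k yxz,zxy,xyz↦x e (prefer yxz y x)
    yzx,zxy,xyz↦z : H yzx zxy xyz ≡ z
    yzx,zxy,xyz↦z = isZ yzx,zxy,xyz↛x yzx,zxy,xyz↛y
    yzx,zxy,xzy↛x : H yzx zxy xzy ≡ x → ⊥
    yzx,zxy,xzy↛x = λ e → sp-b yzx,zxy,xyz↦z e (prefer xyz x z)
    yxz,zxy,xzy↛y : H yxz zxy xzy ≡ y → ⊥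
    yxz,zxy,xzy↛y = λ e → sp-b e yxz,zxy,zxy↦x (prefer xzy x y)
    yxz,zxy,xzy↛z : H yxz zxy xzy ≡ z → ⊥
    yxz,zxy,xzy↛z = λ e → sp-b e yxz,zxy,zxy↦x (prefer xzy x z)
    yxz,zxy,xzy↦x : H yxz zxy xzy ≡ x
    yxz,zxy,xzy↦x = isX yxz,zxy,xzy↛y yxz,zxy,xzy↛z
    yzx,zxy,xzy↛y : H yzx zxy xzy ≡ y → ⊥
    yzx,zxy,xzy↛y = λ e → sp-k yxz,zxy,xzy↦x e (prefer yxz y x)
    yzx,zxy,xzy↦z : H yzx zxy xzy ≡ z
    yzx,zxy,xzy↦z = isZ yzx,zxy,xzy↛x yzx,zxy,xzy↛y
    yzx,xzy,xzy↛y : H yzx xzy xzy ≡ y → ⊥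
    yzx,xzy,xzy↛y = λ e → sp-a e yzx,zxy,xzy↦z (prefer xzy z y)
    yzx,xzy,xzy↛z : H yzx xzy xzy ≡ z → ⊥
    yzx,xzy,xzy↛z = diag≢z

  raise-yxz-yx : H yxz zxy zxy ≡ y → H zyx xyz xyz ≡ x → ⊥
  raise-yxz-yx yxz,zxy,zxy↦y zyx,xyz,xyz↦x = sp-b yzx,xyz,zxy↦y yzx,xyz,xzy↦x (prefer zxy x y)
    where
    yxz,xyz,zxy↛x : H yxz xyz zxy ≡ x → ⊥
    yxz,xyz,zxy↛x = λ e → sp-a yxz,zxy,zxy↦y e (prefer zxy x y)
    yxz,xyz,zxy↛z : H yxz xyz zxy ≡ z → ⊥
    yxz,xyz,zxy↛z = λ e → sp-a e yxz,zxy,zxy↦y (prefer xyz y z)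
    yxz,xyz,zxy↦y : H yxz xyz zxy ≡ y
    yxz,xyz,zxy↦y = isY yxz,xyz,zxy↛x yxz,xyz,zxy↛z
    yzx,xyz,zxy↛x : H yzx xyz zxy ≡ x → ⊥
    yzx,xyz,zxy↛x = λ e → sp-k e yxz,xyz,zxy↦y (prefer yzx y x)
    yzx,xyz,zxy↛z : H yzx xyz zxy ≡ z → ⊥
    yzx,xyz,zxy↛z = λ e → sp-k e yxz,xyz,zxy↦y (prefer yzx y z)
    yzx,xyz,zxy↦y : H yzx xyz zxy ≡ y
    yzx,xyz,zxy↦y = isY yzx,xyz,zxy↛x yzx,xyz,zxy↛z
    zyx,xyz,xzy↛y : H zyx xyz xzy ≡ y → ⊥
    zyx,xyz,xzy↛y = λ e → sp-b e zyx,xyz,xyz↦x (prefer xzy x y)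
    zyx,xyz,xzy↛z : H zyx xyz xzy ≡ z → ⊥
    zyx,xyz,xzy↛z = λ e → sp-b e zyx,xyz,xyz↦x (prefer xzy x z)
    zyx,xyz,xzy↦x : H zyx xyz xzy ≡ x
    zyx,xyz,xzy↦x = isX zyx,xyz,xzy↛y zyx,xyz,xzy↛z
    yzx,xyz,xzy↛y : H yzx xyz xzy ≡ y → ⊥
    yzx,xyz,xzy↛y = λ e → sp-k zyx,xyz,xzy↦x e (prefer zyx y x)
    yzx,xyz,xzy↛z : H yzx xyz xzy ≡ z → ⊥
    yzx,xyz,xzy↛z = λ e → sp-k zyx,xyz,xzy↦x e (prefer zyx z x)
    yzx,xyz,xzy↦x : H yzx xyz xzy ≡ x
    yzx,xyz,xzy↦x = isX yzx,xyz,xzy↛y yzx,xyz,xzy↛z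

  raise-yxz : H yxz zxy zxy ≡ H zyx xyz xyz
  raise-yxz = xy-equal diag≢z diag≢z raise-yxz-xy raise-yxz-yx
  raise-yzx-xy : H yzx xzy xzy ≡ x → H zyx xyz xyz ≡ y → ⊥
  raise-yzx-xy yzx,xzy,xzy↦x zyx,xyz,xyz↦y = zyx,xyz,xzy↛x (isX zyx,xyz,xzy↛y zyx,xyz,xzy↛z)
    where
    zyx,xyz,xzy↛x : H zyx xyz xzy ≡ x → ⊥
    zyx,xyz,xzy↛x = λ e → sp-b zyx,xyz,xyz↦y e (prefer xyz x y)
    yzx,xyz,xzy↛y : H yzx xyz xzy ≡ y → ⊥
    yzx,xyz,xzy↛y = λ e → sp-a e yzx,xzy,xzy↦x (prefer xyz x y)
    yzx,xyz,xzy↛z : H yzx xyz xzy ≡ z → ⊥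
    yzx,xyz,xzy↛z = λ e → sp-a e yzx,xzy,xzy↦x (prefer xyz x z)
    yzx,xyz,xzy↦x : H yzx xyz xzy ≡ x
    yzx,xyz,xzy↦x = isX yzx,xyz,xzy↛y yzx,xyz,xzy↛z
    zyx,xyz,xzy↛y : H zyx xyz xzy ≡ y → ⊥
    zyx,xyz,xzy↛y = λ e → sp-k yzx,xyz,xzy↦x e (prefer yzx y x)
    zyx,xyz,xzy↛z : H zyx xyz xzy ≡ z → ⊥
    zyx,xyz,xzy↛z = λ e → sp-k yzx,xyz,xzy↦x e (prefer yzx z x)

  raise-yzx-yx : H yzx xzy xzy ≡ y → H zyx xyz xyz ≡ x → ⊥
  raise-yzx-yx yzx,xzy,xzy↦y zyx,xyz,xyz↦x = sp-k zyx,xyz,xzy↦x yzx,xyz,xzy↦y (prefer zyx y x)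
    where
    zyx,xyz,xzy↛y : H zyx xyz xzy ≡ y → ⊥
    zyx,xyz,xzy↛y = λ e → sp-b e zyx,xyz,xyz↦x (prefer xzy x y)
    zyx,xyz,xzy↛z : H zyx xyz xzy ≡ z → ⊥
    zyx,xyz,xzy↛z = λ e → sp-b e zyx,xyz,xyz↦x (prefer xzy x z)
    zyx,xyz,xzy↦x : H zyx xyz xzy ≡ x
    zyx,xyz,xzy↦x = isX zyx,xyz,xzy↛y zyx,xyz,xzy↛z
    yzx,xyz,xzy↛x : H yzx xyz xzy ≡ x → ⊥
    yzx,xyz,xzy↛x = λ e → sp-a yzx,xzy,xzy↦y e (prefer xzy x y)
    yzx,xyz,xzy↛z : H yzx xyz xzy ≡ z → ⊥
    yzx,xyz,xzy↛z = λ e → sp-a e yzx,xzy,xzy↦y (prefer xyz y z)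
    yzx,xyz,xzy↦y : H yzx xyz xzy ≡ y
    yzx,xyz,xzy↦y = isY yzx,xyz,xzy↛x yzx,xyz,xzy↛z

  raise-yzx : H yzx xzy xzy ≡ H zyx xyz xyz
  raise-yzx = xy-equal diag≢z diag≢z raise-yzx-xy raise-yzx-yx
  -- The clash behind the final contradiction: when z wins at the anchored entry
  -- (zxy, xyz, zyx), the entries (zxy, yxz, yxz) ↦ y and (zyx, xyz, xyz) ↦ x are
  -- incompatible.
  zxy-clash : H zxy xyz zyx ≡ z → H zxy yxz yxz ≡ y → H zyx xyz xyz ≡ x → ⊥
  zxy-clash zxy,xyz,zyx↦z zxy,yxz,yxz↦y zyx,xyz,xyz↦x = yxz,zxy,zxy↛x (isX yxz,zxy,zxy↛y yxz,zxy,zxy↛z)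
    where
    zxy,yxz,yzx↛x : H zxy yxz yzx ≡ x → ⊥
    zxy,yxz,yzx↛x = λ e → sp-b e zxy,yxz,yxz↦y (prefer yzx y x)
    zxy,yxz,yzx↛z : H zxy yxz yzx ≡ z → ⊥
    zxy,yxz,yzx↛z = λ e → sp-b e zxy,yxz,yxz↦y (prefer yzx y z)
    zxy,yxz,yzx↦y : H zxy yxz yzx ≡ y
    zxy,yxz,yzx↦y = isY zxy,yxz,yzx↛x zxy,yxz,yzx↛z
    xzy,yxz,yzx↛x : H xzy yxz yzx ≡ x → ⊥
    xzy,yxz,yzx↛x = λ e → sp-k zxy,yxz,yzx↦y e (prefer zxy x y)
    xzy,yxz,yzx↛z : H xzy yxz yzx ≡ z → ⊥
    xzy,yxz,yzx↛z = λ e → sp-k zxy,yxz,yzx↦y e (prefer zxy z y)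
    xzy,yxz,yzx↦y : H xzy yxz yzx ≡ y
    xzy,yxz,yzx↦y = isY xzy,yxz,yzx↛x xzy,yxz,yzx↛z
    xzy,yxz,zyx↛x : H xzy yxz zyx ≡ x → ⊥
    xzy,yxz,zyx↛x = λ e → sp-b e xzy,yxz,yzx↦y (prefer zyx y x)
    zxy,yxz,zyx↛x : H zxy yxz zyx ≡ x → ⊥
    zxy,yxz,zyx↛x = λ e → sp-a zxy,xyz,zyx↦z e (prefer xyz x z)
    zxy,yxz,zyx↛y : H zxy yxz zyx ≡ y → ⊥
    zxy,yxz,zyx↛y = λ e → sp-a zxy,xyz,zyx↦z e (prefer xyz y z)
    zxy,yxz,zyx↦z : H zxy yxz zyx ≡ z
    zxy,yxz,zyx↦z = isZ zxy,yxz,zyx↛x zxy,yxz,zyx↛y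
    xzy,yxz,zyx↛y : H xzy yxz zyx ≡ y → ⊥
    xzy,yxz,zyx↛y = λ e → sp-k e zxy,yxz,zyx↦z (prefer xzy z y)
    xzy,yxz,zyx↦z : H xzy yxz zyx ≡ z
    xzy,yxz,zyx↦z = isZ xzy,yxz,zyx↛x xzy,yxz,zyx↛y
    xzy,yxz,zxy↛x : H xzy yxz zxy ≡ x → ⊥
    xzy,yxz,zxy↛x = λ e → sp-b e xzy,yxz,zyx↦z (prefer zxy z x)
    zxy,yxz,zxy↛x : H zxy yxz zxy ≡ x → ⊥
    zxy,yxz,zxy↛x = λ e → sp-b e zxy,yxz,zyx↦z (prefer zxy z x)
    zxy,yxz,zxy↛y : H zxy yxz zxy ≡ y → ⊥
    zxy,yxz,zxy↛y = λ e → sp-b e zxy,yxz,zyx↦z (prefer zxy z y)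
    zxy,yxz,zxy↦z : H zxy yxz zxy ≡ z
    zxy,yxz,zxy↦z = isZ zxy,yxz,zxy↛x zxy,yxz,zxy↛y
    xzy,yxz,zxy↛y : H xzy yxz zxy ≡ y → ⊥
    xzy,yxz,zxy↛y = λ e → sp-k e zxy,yxz,zxy↦z (prefer xzy z y)
    xzy,yxz,zxy↦z : H xzy yxz zxy ≡ z
    xzy,yxz,zxy↦z = isZ xzy,yxz,zxy↛x xzy,yxz,zxy↛y
    yxz,yxz,zxy↛x : H yxz yxz zxy ≡ x → ⊥
    yxz,yxz,zxy↛x = λ e → sp-k xzy,yxz,zxy↦z e (prefer xzy x z)
    yzx,yxz,zxy↛x : H yzx yxz zxy ≡ x → ⊥
    yzx,yxz,zxy↛x = λ e → sp-k e zxy,yxz,zxy↦z (prefer yzx z x)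
    zyx,xyz,zyx↛x : H zyx xyz zyx ≡ x → ⊥
    zyx,xyz,zyx↛x = λ e → sp-k e zxy,xyz,zyx↦z (prefer zyx z x)
    zyx,xyz,zyx↛y : H zyx xyz zyx ≡ y → ⊥
    zyx,xyz,zyx↛y = λ e → sp-k e zxy,xyz,zyx↦z (prefer zyx z y)
    zyx,xyz,zyx↦z : H zyx xyz zyx ≡ z
    zyx,xyz,zyx↦z = isZ zyx,xyz,zyx↛x zyx,xyz,zyx↛y
    zyx,xyz,zxy↛x : H zyx xyz zxy ≡ x → ⊥
    zyx,xyz,zxy↛x = λ e → sp-b e zyx,xyz,zyx↦z (prefer zxy z x)
    zyx,xyz,zxy↛y : H zyx xyz zxy ≡ y → ⊥
    zyx,xyz,zxy↛y = λ e → sp-b e zyx,xyz,xyz↦x (prefer zxy x y)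
    zyx,xyz,zxy↦z : H zyx xyz zxy ≡ z
    zyx,xyz,zxy↦z = isZ zyx,xyz,zxy↛x zyx,xyz,zxy↛y
    yzx,xyz,zxy↛x : H yzx xyz zxy ≡ x → ⊥
    yzx,xyz,zxy↛x = λ e → sp-k e zyx,xyz,zxy↦z (prefer yzx z x)
    zyx,xyz,xzy↛y : H zyx xyz xzy ≡ y → ⊥
    zyx,xyz,xzy↛y = λ e → sp-b e zyx,xyz,xyz↦x (prefer xzy x y)
    zyx,xyz,xzy↛z : H zyx xyz xzy ≡ z → ⊥
    zyx,xyz,xzy↛z = λ e → sp-b e zyx,xyz,xyz↦x (prefer xzy x z)
    zyx,xyz,xzy↦x : H zyx xyz xzy ≡ x
    zyx,xyz,xzy↦x = isX zyx,xyz,xzy↛y zyx,xyz,xzy↛z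
    yzx,xyz,xzy↛y : H yzx xyz xzy ≡ y → ⊥
    yzx,xyz,xzy↛y = λ e → sp-k zyx,xyz,xzy↦x e (prefer zyx y x)
    yzx,xyz,xzy↛z : H yzx xyz xzy ≡ z → ⊥
    yzx,xyz,xzy↛z = λ e → sp-k zyx,xyz,xzy↦x e (prefer zyx z x)
    yzx,xyz,xzy↦x : H yzx xyz xzy ≡ x
    yzx,xyz,xzy↦x = isX yzx,xyz,xzy↛y yzx,xyz,xzy↛z
    yzx,xyz,zxy↛y : H yzx xyz zxy ≡ y → ⊥
    yzx,xyz,zxy↛y = λ e → sp-b e yzx,xyz,xzy↦x (prefer zxy x y)
    yzx,xyz,zxy↦z : H yzx xyz zxy ≡ z
    yzx,xyz,zxy↦z = isZ yzx,xyz,zxy↛x yzx,xyz,zxy↛y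
    yzx,yxz,zxy↛y : H yzx yxz zxy ≡ y → ⊥
    yzx,yxz,zxy↛y = λ e → sp-a yzx,xyz,zxy↦z e (prefer xyz y z)
    yzx,yxz,zxy↦z : H yzx yxz zxy ≡ z
    yzx,yxz,zxy↦z = isZ yzx,yxz,zxy↛x yzx,yxz,zxy↛y
    yxz,yxz,zxy↛y : H yxz yxz zxy ≡ y → ⊥
    yxz,yxz,zxy↛y = λ e → sp-k yzx,yxz,zxy↦z e (prefer yzx y z)
    yxz,yxz,zxy↦z : H yxz yxz zxy ≡ z
    yxz,yxz,zxy↦z = isZ yxz,yxz,zxy↛x yxz,yxz,zxy↛y
    yxz,zxy,zxy↛x : H yxz zxy zxy ≡ x → ⊥
    yxz,zxy,zxy↛x = λ e → sp-a yxz,yxz,zxy↦z e (prefer yxz x z)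
    yxz,zxy,zxy↛y : H yxz zxy zxy ≡ y → ⊥
    yxz,zxy,zxy↛y = λ e → sp-a yxz,yxz,zxy↦z e (prefer yxz y z)
    yxz,zxy,zxy↛z : H yxz zxy zxy ≡ z → ⊥
    yxz,zxy,zxy↛z = diag≢z

  z-spread-xzy-zxy : H xzy yzx zxy ≡ z → H zxy xyz zyx ≡ z
  z-spread-xzy-zxy xzy,yzx,zxy↦z = zxy,xyz,zyx↦z
    where
    xzy,yzx,yzx↛x : H xzy yzx yzx ≡ x → ⊥
    xzy,yzx,yzx↛x = λ e → sp-b e xzy,yzx,zxy↦z (prefer yzx z x)
    xzy,yzx,yzx↛z : H xzy yzx yzx ≡ z → ⊥
    xzy,yzx,yzx↛z = diag≢z
    xzy,yzx,yzx↦y : H xzy yzx yzx ≡ y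
    xzy,yzx,yzx↦y = isY xzy,yzx,yzx↛x xzy,yzx,yzx↛z
    xzy,yxz,yzx↛x : H xzy yxz yzx ≡ x → ⊥
    xzy,yxz,yzx↛x = λ e → sp-a e xzy,yzx,yzx↦y (prefer yxz y x)
    xzy,yxz,yzx↛z : H xzy yxz yzx ≡ z → ⊥
    xzy,yxz,yzx↛z = λ e → sp-a e xzy,yzx,yzx↦y (prefer yxz y z)
    xzy,yxz,yzx↦y : H xzy yxz yzx ≡ y
    xzy,yxz,yzx↦y = isY xzy,yxz,yzx↛x xzy,yxz,yzx↛z
    xzy,yxz,zyx↛x : H xzy yxz zyx ≡ x → ⊥
    xzy,yxz,zyx↛x = λ e → sp-b e xzy,yxz,yzx↦y (prefer zyx y x)
    xzy,yzx,zyx↛x : H xzy yzx zyx ≡ x → ⊥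
    xzy,yzx,zyx↛x = λ e → sp-b e xzy,yzx,zxy↦z (prefer zyx z x)
    xzy,yzx,zyx↛y : H xzy yzx zyx ≡ y → ⊥
    xzy,yzx,zyx↛y = λ e → sp-b e xzy,yzx,zxy↦z (prefer zyx z y)
    xzy,yzx,zyx↦z : H xzy yzx zyx ≡ z
    xzy,yzx,zyx↦z = isZ xzy,yzx,zyx↛x xzy,yzx,zyx↛y
    xzy,yxz,zyx↛y : H xzy yxz zyx ≡ y → ⊥
    xzy,yxz,zyx↛y = λ e → sp-a xzy,yzx,zyx↦z e (prefer yzx y z)
    xzy,yxz,zyx↦z : H xzy yxz zyx ≡ z
    xzy,yxz,zyx↦z = isZ xzy,yxz,zyx↛x xzy,yxz,zyx↛y
    xzy,xyz,zyx↛x : H xzy xyz zyx ≡ x → ⊥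
    xzy,xyz,zyx↛x = λ e → sp-a xzy,yxz,zyx↦z e (prefer yxz x z)
    xzy,xyz,zyx↛y : H xzy xyz zyx ≡ y → ⊥
    xzy,xyz,zyx↛y = λ e → sp-a xzy,yzx,zyx↦z e (prefer yzx y z)
    xzy,xyz,zyx↦z : H xzy xyz zyx ≡ z
    xzy,xyz,zyx↦z = isZ xzy,xyz,zyx↛x xzy,xyz,zyx↛y
    zxy,xyz,zyx↛x : H zxy xyz zyx ≡ x → ⊥
    zxy,xyz,zyx↛x = λ e → sp-k xzy,xyz,zyx↦z e (prefer xzy x z)
    zxy,xyz,zyx↛y : H zxy xyz zyx ≡ y → ⊥
    zxy,xyz,zyx↛y = λ e → sp-k e xzy,xyz,zyx↦z (prefer zxy z y)
    zxy,xyz,zyx↦z : H zxy xyz zyx ≡ z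
    zxy,xyz,zyx↦z = isZ zxy,xyz,zyx↛x zxy,xyz,zyx↛y

  z-spread-yzx-zxy : H yzx xzy zxy ≡ z → H zxy xyz zyx ≡ z
  z-spread-yzx-zxy yzx,xzy,zxy↦z = zxy,xyz,zyx↦z
    where
    yzx,xzy,zyx↛x : H yzx xzy zyx ≡ x → ⊥
    yzx,xzy,zyx↛x = λ e → sp-b e yzx,xzy,zxy↦z (prefer zyx z x)
    yzx,xzy,zyx↛y : H yzx xzy zyx ≡ y → ⊥
    yzx,xzy,zyx↛y = λ e → sp-b e yzx,xzy,zxy↦z (prefer zyx z y)
    yzx,xzy,zyx↦z : H yzx xzy zyx ≡ z
    yzx,xzy,zyx↦z = isZ yzx,xzy,zyx↛x yzx,xzy,zyx↛y
    yzx,xyz,zyx↛x : H yzx xyz zyx ≡ x → ⊥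
    yzx,xyz,zyx↛x = λ e → sp-a yzx,xzy,zyx↦z e (prefer xzy x z)
    yzx,xyz,zxy↛x : H yzx xyz zxy ≡ x → ⊥
    yzx,xyz,zxy↛x = λ e → sp-a yzx,xzy,zxy↦z e (prefer xzy x z)
    yzx,xzy,xzy↛y : H yzx xzy xzy ≡ y → ⊥
    yzx,xzy,xzy↛y = λ e → sp-b e yzx,xzy,zxy↦z (prefer xzy z y)
    yzx,xzy,xzy↛z : H yzx xzy xzy ≡ z → ⊥
    yzx,xzy,xzy↛z = diag≢z
    yzx,xzy,xzy↦x : H yzx xzy xzy ≡ x
    yzx,xzy,xzy↦x = isX yzx,xzy,xzy↛y yzx,xzy,xzy↛z
    yzx,xyz,xzy↛y : H yzx xyz xzy ≡ y → ⊥
    yzx,xyz,xzy↛y = λ e → sp-a e yzx,xzy,xzy↦x (prefer xyz x y)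
    yzx,xyz,xzy↛z : H yzx xyz xzy ≡ z → ⊥
    yzx,xyz,xzy↛z = λ e → sp-a e yzx,xzy,xzy↦x (prefer xyz x z)
    yzx,xyz,xzy↦x : H yzx xyz xzy ≡ x
    yzx,xyz,xzy↦x = isX yzx,xyz,xzy↛y yzx,xyz,xzy↛z
    yzx,xyz,zxy↛y : H yzx xyz zxy ≡ y → ⊥
    yzx,xyz,zxy↛y = λ e → sp-b e yzx,xyz,xzy↦x (prefer zxy x y)
    yzx,xyz,zxy↦z : H yzx xyz zxy ≡ z
    yzx,xyz,zxy↦z = isZ yzx,xyz,zxy↛x yzx,xyz,zxy↛y
    yzx,xyz,zyx↛y : H yzx xyz zyx ≡ y → ⊥
    yzx,xyz,zyx↛y = λ e → sp-b e yzx,xyz,zxy↦z (prefer zyx z y)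
    yzx,xyz,zyx↦z : H yzx xyz zyx ≡ z
    yzx,xyz,zyx↦z = isZ yzx,xyz,zyx↛x yzx,xyz,zyx↛y
    zxy,xyz,zyx↛x : H zxy xyz zyx ≡ x → ⊥
    zxy,xyz,zyx↛x = λ e → sp-k e yzx,xyz,zyx↦z (prefer zxy z x)
    zxy,xyz,zyx↛y : H zxy xyz zyx ≡ y → ⊥
    zxy,xyz,zyx↛y = λ e → sp-k yzx,xyz,zyx↦z e (prefer yzx y z)
    zxy,xyz,zyx↦z : H zxy xyz zyx ≡ z
    zxy,xyz,zyx↦z = isZ zxy,xyz,zyx↛x zxy,xyz,zyx↛y

  z-spread-xzy-zyx : H xzy yzx zyx ≡ z → H zxy xyz zyx ≡ z
  z-spread-xzy-zyx xzy,yzx,zyx↦z = zxy,xyz,zyx↦z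
    where
    xzy,yzx,yzx↛x : H xzy yzx yzx ≡ x → ⊥
    xzy,yzx,yzx↛x = λ e → sp-b e xzy,yzx,zyx↦z (prefer yzx z x)
    xzy,yzx,yzx↛z : H xzy yzx yzx ≡ z → ⊥
    xzy,yzx,yzx↛z = diag≢z
    xzy,yzx,yzx↦y : H xzy yzx yzx ≡ y
    xzy,yzx,yzx↦y = isY xzy,yzx,yzx↛x xzy,yzx,yzx↛z
    xzy,yxz,yzx↛x : H xzy yxz yzx ≡ x → ⊥
    xzy,yxz,yzx↛x = λ e → sp-a e xzy,yzx,yzx↦y (prefer yxz y x)
    xzy,yxz,yzx↛z : H xzy yxz yzx ≡ z → ⊥
    xzy,yxz,yzx↛z = λ e → sp-a e xzy,yzx,yzx↦y (prefer yxz y z)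
    xzy,yxz,yzx↦y : H xzy yxz yzx ≡ y
    xzy,yxz,yzx↦y = isY xzy,yxz,yzx↛x xzy,yxz,yzx↛z
    xzy,yxz,zyx↛x : H xzy yxz zyx ≡ x → ⊥
    xzy,yxz,zyx↛x = λ e → sp-b e xzy,yxz,yzx↦y (prefer zyx y x)
    xzy,yxz,zyx↛y : H xzy yxz zyx ≡ y → ⊥
    xzy,yxz,zyx↛y = λ e → sp-a xzy,yzx,zyx↦z e (prefer yzx y z)
    xzy,yxz,zyx↦z : H xzy yxz zyx ≡ z
    xzy,yxz,zyx↦z = isZ xzy,yxz,zyx↛x xzy,yxz,zyx↛y
    xzy,xyz,zyx↛x : H xzy xyz zyx ≡ x → ⊥
    xzy,xyz,zyx↛x = λ e → sp-a xzy,yxz,zyx↦z e (prefer yxz x z)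
    xzy,xyz,zyx↛y : H xzy xyz zyx ≡ y → ⊥
    xzy,xyz,zyx↛y = λ e → sp-a xzy,yzx,zyx↦z e (prefer yzx y z)
    xzy,xyz,zyx↦z : H xzy xyz zyx ≡ z
    xzy,xyz,zyx↦z = isZ xzy,xyz,zyx↛x xzy,xyz,zyx↛y
    zxy,xyz,zyx↛x : H zxy xyz zyx ≡ x → ⊥
    zxy,xyz,zyx↛x = λ e → sp-k xzy,xyz,zyx↦z e (prefer xzy x z)
    zxy,xyz,zyx↛y : H zxy xyz zyx ≡ y → ⊥
    zxy,xyz,zyx↛y = λ e → sp-k e xzy,xyz,zyx↦z (prefer zxy z y)
    zxy,xyz,zyx↦z : H zxy xyz zyx ≡ z
    zxy,xyz,zyx↦z = isZ zxy,xyz,zyx↛x zxy,xyz,zyx↛y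

  z-spread-yzx-zyx : H yzx xzy zyx ≡ z → H zxy xyz zyx ≡ z
  z-spread-yzx-zyx yzx,xzy,zyx↦z = zxy,xyz,zyx↦z
    where
    yzx,xyz,zyx↛x : H yzx xyz zyx ≡ x → ⊥
    yzx,xyz,zyx↛x = λ e → sp-a yzx,xzy,zyx↦z e (prefer xzy x z)
    yzx,xzy,zxy↛x : H yzx xzy zxy ≡ x → ⊥
    yzx,xzy,zxy↛x = λ e → sp-b e yzx,xzy,zyx↦z (prefer zxy z x)
    yzx,xzy,zxy↛y : H yzx xzy zxy ≡ y → ⊥
    yzx,xzy,zxy↛y = λ e → sp-b e yzx,xzy,zyx↦z (prefer zxy z y)
    yzx,xzy,zxy↦z : H yzx xzy zxy ≡ z
    yzx,xzy,zxy↦z = isZ yzx,xzy,zxy↛x yzx,xzy,zxy↛y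
    yzx,xyz,zxy↛x : H yzx xyz zxy ≡ x → ⊥
    yzx,xyz,zxy↛x = λ e → sp-a yzx,xzy,zxy↦z e (prefer xzy x z)
    yzx,xzy,xzy↛y : H yzx xzy xzy ≡ y → ⊥
    yzx,xzy,xzy↛y = λ e → sp-b e yzx,xzy,zyx↦z (prefer xzy z y)
    yzx,xzy,xzy↛z : H yzx xzy xzy ≡ z → ⊥
    yzx,xzy,xzy↛z = diag≢z
    yzx,xzy,xzy↦x : H yzx xzy xzy ≡ x
    yzx,xzy,xzy↦x = isX yzx,xzy,xzy↛y yzx,xzy,xzy↛z
    yzx,xyz,xzy↛y : H yzx xyz xzy ≡ y → ⊥
    yzx,xyz,xzy↛y = λ e → sp-a e yzx,xzy,xzy↦x (prefer xyz x y)
    yzx,xyz,xzy↛z : H yzx xyz xzy ≡ z → ⊥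
    yzx,xyz,xzy↛z = λ e → sp-a e yzx,xzy,xzy↦x (prefer xyz x z)
    yzx,xyz,xzy↦x : H yzx xyz xzy ≡ x
    yzx,xyz,xzy↦x = isX yzx,xyz,xzy↛y yzx,xyz,xzy↛z
    yzx,xyz,zxy↛y : H yzx xyz zxy ≡ y → ⊥
    yzx,xyz,zxy↛y = λ e → sp-b e yzx,xyz,xzy↦x (prefer zxy x y)
    yzx,xyz,zxy↦z : H yzx xyz zxy ≡ z
    yzx,xyz,zxy↦z = isZ yzx,xyz,zxy↛x yzx,xyz,zxy↛y
    yzx,xyz,zyx↛y : H yzx xyz zyx ≡ y → ⊥
    yzx,xyz,zyx↛y = λ e → sp-b e yzx,xyz,zxy↦z (prefer zyx z y)
    yzx,xyz,zyx↦z : H yzx xyz zyx ≡ z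
    yzx,xyz,zyx↦z = isZ yzx,xyz,zyx↛x yzx,xyz,zyx↛y
    zxy,xyz,zyx↛x : H zxy xyz zyx ≡ x → ⊥
    zxy,xyz,zyx↛x = λ e → sp-k e yzx,xyz,zyx↦z (prefer zxy z x)
    zxy,xyz,zyx↛y : H zxy xyz zyx ≡ y → ⊥
    zxy,xyz,zyx↛y = λ e → sp-k yzx,xyz,zyx↦z e (prefer yzx y z)
    zxy,xyz,zyx↦z : H zxy xyz zyx ≡ z
    zxy,xyz,zyx↦z = isZ zxy,xyz,zyx↛x zxy,xyz,zyx↛y

  z-split-zxy-x : H zxy xzy yzx ≡ z → H xyz xyz zyx ≡ x → H zxy xyz zyx ≡ z
  z-split-zxy-x zxy,xzy,yzx↦z xyz,xyz,zyx↦x = zxy,xyz,zyx↦z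
    where
    zxy,xyz,yzx↛x : H zxy xyz yzx ≡ x → ⊥
    zxy,xyz,yzx↛x = λ e → sp-a zxy,xzy,yzx↦z e (prefer xzy x z)
    xzy,xyz,zyx↛y : H xzy xyz zyx ≡ y → ⊥
    xzy,xyz,zyx↛y = λ e → sp-k e xyz,xyz,zyx↦x (prefer xzy x y)
    xzy,xyz,zyx↛z : H xzy xyz zyx ≡ z → ⊥
    xzy,xyz,zyx↛z = λ e → sp-k e xyz,xyz,zyx↦x (prefer xzy x z)
    xzy,xyz,zyx↦x : H xzy xyz zyx ≡ x
    xzy,xyz,zyx↦x = isX xzy,xyz,zyx↛y xzy,xyz,zyx↛z
    xzy,xyz,yzx↛y : H xzy xyz yzx ≡ y → ⊥
    xzy,xyz,yzx↛y = λ e → sp-b xzy,xyz,zyx↦x e (prefer zyx y x)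
    xzy,xyz,yzx↛z : H xzy xyz yzx ≡ z → ⊥
    xzy,xyz,yzx↛z = λ e → sp-b xzy,xyz,zyx↦x e (prefer zyx z x)
    xzy,xyz,yzx↦x : H xzy xyz yzx ≡ x
    xzy,xyz,yzx↦x = isX xzy,xyz,yzx↛y xzy,xyz,yzx↛z
    zxy,xyz,yzx↛y : H zxy xyz yzx ≡ y → ⊥
    zxy,xyz,yzx↛y = λ e → sp-k e xzy,xyz,yzx↦x (prefer zxy x y)
    zxy,xyz,yzx↦z : H zxy xyz yzx ≡ z
    zxy,xyz,yzx↦z = isZ zxy,xyz,yzx↛x zxy,xyz,yzx↛y
    zxy,xyz,zyx↛x : H zxy xyz zyx ≡ x → ⊥
    zxy,xyz,zyx↛x = λ e → sp-b e zxy,xyz,yzx↦z (prefer zyx z x)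
    zxy,xyz,zyx↛y : H zxy xyz zyx ≡ y → ⊥
    zxy,xyz,zyx↛y = λ e → sp-k e xyz,xyz,zyx↦x (prefer zxy x y)
    zxy,xyz,zyx↦z : H zxy xyz zyx ≡ z
    zxy,xyz,zyx↦z = isZ zxy,xyz,zyx↛x zxy,xyz,zyx↛y

  z-split-zxy-y : H zxy xzy yzx ≡ z → H xyz xyz zyx ≡ y → H zxy zxy yxz ≡ z
  z-split-zxy-y zxy,xzy,yzx↦z xyz,xyz,zyx↦y = zxy,zxy,yxz↦z
    where
    xyz,zxy,zyx↛x : H xyz zxy zyx ≡ x → ⊥
    xyz,zxy,zyx↛x = λ e → sp-a xyz,xyz,zyx↦y e (prefer xyz x y)
    xyz,zyx,zyx↛x : H xyz zyx zyx ≡ x → ⊥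
    xyz,zyx,zyx↛x = λ e → sp-a xyz,xyz,zyx↦y e (prefer xyz x y)
    xyz,zyx,zyx↛z : H xyz zyx zyx ≡ z → ⊥
    xyz,zyx,zyx↛z = diag≢z
    xyz,zyx,zyx↦y : H xyz zyx zyx ≡ y
    xyz,zyx,zyx↦y = isY xyz,zyx,zyx↛x xyz,zyx,zyx↛z
    xyz,zxy,zyx↛z : H xyz zxy zyx ≡ z → ⊥
    xyz,zxy,zyx↛z = λ e → sp-a xyz,zyx,zyx↦y e (prefer zyx z y)
    xyz,zxy,zyx↦y : H xyz zxy zyx ≡ y
    xyz,zxy,zyx↦y = isY xyz,zxy,zyx↛x xyz,zxy,zyx↛z
    xyz,zxy,yxz↛x : H xyz zxy yxz ≡ x → ⊥
    xyz,zxy,yxz↛x = λ e → sp-b e xyz,zxy,zyx↦y (prefer yxz y x)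
    xyz,zxy,yxz↛z : H xyz zxy yxz ≡ z → ⊥
    xyz,zxy,yxz↛z = λ e → sp-b xyz,zxy,zyx↦y e (prefer zyx z y)
    xyz,zxy,yxz↦y : H xyz zxy yxz ≡ y
    xyz,zxy,yxz↦y = isY xyz,zxy,yxz↛x xyz,zxy,yxz↛z
    zxy,zxy,yxz↛x : H zxy zxy yxz ≡ x → ⊥
    zxy,zxy,yxz↛x = λ e → sp-k xyz,zxy,yxz↦y e (prefer xyz x y)
    xzy,zxy,yxz↛x : H xzy zxy yxz ≡ x → ⊥
    xzy,zxy,yxz↛x = λ e → sp-k xyz,zxy,yxz↦y e (prefer xyz x y)
    xyz,zxy,yzx↛x : H xyz zxy yzx ≡ x → ⊥
    xyz,zxy,yzx↛x = λ e → sp-b e xyz,zxy,zyx↦y (prefer yzx y x)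
    xyz,zxy,yzx↛z : H xyz zxy yzx ≡ z → ⊥
    xyz,zxy,yzx↛z = λ e → sp-b xyz,zxy,zyx↦y e (prefer zyx z y)
    xyz,zxy,yzx↦y : H xyz zxy yzx ≡ y
    xyz,zxy,yzx↦y = isY xyz,zxy,yzx↛x xyz,zxy,yzx↛z
    xzy,zxy,yzx↛x : H xzy zxy yzx ≡ x → ⊥
    xzy,zxy,yzx↛x = λ e → sp-k xyz,zxy,yzx↦y e (prefer xyz x y)
    xyz,xzy,zyx↛x : H xyz xzy zyx ≡ x → ⊥
    xyz,xzy,zyx↛x = λ e → sp-a xyz,xyz,zyx↦y e (prefer xyz x y)
    xyz,xzy,zyx↛z : H xyz xzy zyx ≡ z → ⊥
    xyz,xzy,zyx↛z = λ e → sp-a xyz,zyx,zyx↦y e (prefer zyx z y)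
    xyz,xzy,zyx↦y : H xyz xzy zyx ≡ y
    xyz,xzy,zyx↦y = isY xyz,xzy,zyx↛x xyz,xzy,zyx↛z
    xyz,xzy,yzx↛x : H xyz xzy yzx ≡ x → ⊥
    xyz,xzy,yzx↛x = λ e → sp-b e xyz,xzy,zyx↦y (prefer yzx y x)
    xyz,xzy,yzx↛z : H xyz xzy yzx ≡ z → ⊥
    xyz,xzy,yzx↛z = λ e → sp-b xyz,xzy,zyx↦y e (prefer zyx z y)
    xyz,xzy,yzx↦y : H xyz xzy yzx ≡ y
    xyz,xzy,yzx↦y = isY xyz,xzy,yzx↛x xyz,xzy,yzx↛z
    xzy,xzy,yzx↛x : H xzy xzy yzx ≡ x → ⊥
    xzy,xzy,yzx↛x = λ e → sp-k xyz,xzy,yzx↦y e (prefer xyz x y)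
    xzy,xzy,yzx↛y : H xzy xzy yzx ≡ y → ⊥
    xzy,xzy,yzx↛y = λ e → sp-k e zxy,xzy,yzx↦z (prefer xzy z y)
    xzy,xzy,yzx↦z : H xzy xzy yzx ≡ z
    xzy,xzy,yzx↦z = isZ xzy,xzy,yzx↛x xzy,xzy,yzx↛y
    xzy,zxy,yzx↛y : H xzy zxy yzx ≡ y → ⊥
    xzy,zxy,yzx↛y = λ e → sp-a e xzy,xzy,yzx↦z (prefer zxy z y)
    xzy,zxy,yzx↦z : H xzy zxy yzx ≡ z
    xzy,zxy,yzx↦z = isZ xzy,zxy,yzx↛x xzy,zxy,yzx↛y
    xzy,zxy,yxz↛y : H xzy zxy yxz ≡ y → ⊥
    xzy,zxy,yxz↛y = λ e → sp-b xzy,zxy,yzx↦z e (prefer yzx y z)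
    xzy,zxy,yxz↦z : H xzy zxy yxz ≡ z
    xzy,zxy,yxz↦z = isZ xzy,zxy,yxz↛x xzy,zxy,yxz↛y
    zxy,zxy,yxz↛y : H zxy zxy yxz ≡ y → ⊥
    zxy,zxy,yxz↛y = λ e → sp-k e xzy,zxy,yxz↦z (prefer zxy z y)
    zxy,zxy,yxz↦z : H zxy zxy yxz ≡ z
    zxy,zxy,yxz↦z = isZ zxy,zxy,yxz↛x zxy,zxy,yxz↛y

  z-split-zxy : H zxy xzy yzx ≡ z → (H zxy xyz zyx ≡ z) ⊎ (H zxy zxy yxz ≡ z)
  z-split-zxy zxy,xzy,yzx↦z =
    caseX (H xyz xyz zyx) (inj₁ ∘ z-split-zxy-x zxy,xzy,yzx↦z) (inj₂ ∘ z-split-zxy-y zxy,xzy,yzx↦z)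
          (⊥-elim ∘ z-loses-xyz-xyz-zyx)

  z-split-zyx-x : H zyx xzy yzx ≡ z → H xyz xyz zyx ≡ x → H zxy xyz zyx ≡ z
  z-split-zyx-x zyx,xzy,yzx↦z xyz,xyz,zyx↦x = zxy,xyz,zyx↦z
    where
    zxy,xzy,yzx↛x : H zxy xzy yzx ≡ x → ⊥
    zxy,xzy,yzx↛x = λ e → sp-k e zyx,xzy,yzx↦z (prefer zxy z x)
    zxy,xzy,yzx↛y : H zxy xzy yzx ≡ y → ⊥
    zxy,xzy,yzx↛y = λ e → sp-k e zyx,xzy,yzx↦z (prefer zxy z y)
    zxy,xzy,yzx↦z : H zxy xzy yzx ≡ z
    zxy,xzy,yzx↦z = isZ zxy,xzy,yzx↛x zxy,xzy,yzx↛y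
    zxy,xyz,yzx↛x : H zxy xyz yzx ≡ x → ⊥
    zxy,xyz,yzx↛x = λ e → sp-a zxy,xzy,yzx↦z e (prefer xzy x z)
    xzy,xyz,zyx↛y : H xzy xyz zyx ≡ y → ⊥
    xzy,xyz,zyx↛y = λ e → sp-k e xyz,xyz,zyx↦x (prefer xzy x y)
    xzy,xyz,zyx↛z : H xzy xyz zyx ≡ z → ⊥
    xzy,xyz,zyx↛z = λ e → sp-k e xyz,xyz,zyx↦x (prefer xzy x z)
    xzy,xyz,zyx↦x : H xzy xyz zyx ≡ x
    xzy,xyz,zyx↦x = isX xzy,xyz,zyx↛y xzy,xyz,zyx↛z
    xzy,xyz,yzx↛y : H xzy xyz yzx ≡ y → ⊥
    xzy,xyz,yzx↛y = λ e → sp-b xzy,xyz,zyx↦x e (prefer zyx y x)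
    xzy,xyz,yzx↛z : H xzy xyz yzx ≡ z → ⊥
    xzy,xyz,yzx↛z = λ e → sp-b xzy,xyz,zyx↦x e (prefer zyx z x)
    xzy,xyz,yzx↦x : H xzy xyz yzx ≡ x
    xzy,xyz,yzx↦x = isX xzy,xyz,yzx↛y xzy,xyz,yzx↛z
    zxy,xyz,yzx↛y : H zxy xyz yzx ≡ y → ⊥
    zxy,xyz,yzx↛y = λ e → sp-k e xzy,xyz,yzx↦x (prefer zxy x y)
    zxy,xyz,yzx↦z : H zxy xyz yzx ≡ z
    zxy,xyz,yzx↦z = isZ zxy,xyz,yzx↛x zxy,xyz,yzx↛y
    zxy,xyz,zyx↛x : H zxy xyz zyx ≡ x → ⊥
    zxy,xyz,zyx↛x = λ e → sp-b e zxy,xyz,yzx↦z (prefer zyx z x)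
    zxy,xyz,zyx↛y : H zxy xyz zyx ≡ y → ⊥
    zxy,xyz,zyx↛y = λ e → sp-k e xyz,xyz,zyx↦x (prefer zxy x y)
    zxy,xyz,zyx↦z : H zxy xyz zyx ≡ z
    zxy,xyz,zyx↦z = isZ zxy,xyz,zyx↛x zxy,xyz,zyx↛y

  z-split-zyx-y : H zyx xzy yzx ≡ z → H xyz xyz zyx ≡ y → H zxy zxy yxz ≡ z
  z-split-zyx-y zyx,xzy,yzx↦z xyz,xyz,zyx↦y = zxy,zxy,yxz↦z
    where
    xyz,zxy,zyx↛x : H xyz zxy zyx ≡ x → ⊥
    xyz,zxy,zyx↛x = λ e → sp-a xyz,xyz,zyx↦y e (prefer xyz x y)
    xyz,zyx,zyx↛x : H xyz zyx zyx ≡ x → ⊥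
    xyz,zyx,zyx↛x = λ e → sp-a xyz,xyz,zyx↦y e (prefer xyz x y)
    xyz,zyx,zyx↛z : H xyz zyx zyx ≡ z → ⊥
    xyz,zyx,zyx↛z = diag≢z
    xyz,zyx,zyx↦y : H xyz zyx zyx ≡ y
    xyz,zyx,zyx↦y = isY xyz,zyx,zyx↛x xyz,zyx,zyx↛z
    xyz,zxy,zyx↛z : H xyz zxy zyx ≡ z → ⊥
    xyz,zxy,zyx↛z = λ e → sp-a xyz,zyx,zyx↦y e (prefer zyx z y)
    xyz,zxy,zyx↦y : H xyz zxy zyx ≡ y
    xyz,zxy,zyx↦y = isY xyz,zxy,zyx↛x xyz,zxy,zyx↛z
    xyz,zxy,yxz↛x : H xyz zxy yxz ≡ x → ⊥
    xyz,zxy,yxz↛x = λ e → sp-b e xyz,zxy,zyx↦y (prefer yxz y x)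
    xyz,zxy,yxz↛z : H xyz zxy yxz ≡ z → ⊥
    xyz,zxy,yxz↛z = λ e → sp-b xyz,zxy,zyx↦y e (prefer zyx z y)
    xyz,zxy,yxz↦y : H xyz zxy yxz ≡ y
    xyz,zxy,yxz↦y = isY xyz,zxy,yxz↛x xyz,zxy,yxz↛z
    zxy,zxy,yxz↛x : H zxy zxy yxz ≡ x → ⊥
    zxy,zxy,yxz↛x = λ e → sp-k xyz,zxy,yxz↦y e (prefer xyz x y)
    xzy,zxy,yxz↛x : H xzy zxy yxz ≡ x → ⊥
    xzy,zxy,yxz↛x = λ e → sp-k xyz,zxy,yxz↦y e (prefer xyz x y)
    xyz,zxy,yzx↛x : H xyz zxy yzx ≡ x → ⊥
    xyz,zxy,yzx↛x = λ e → sp-b e xyz,zxy,zyx↦y (prefer yzx y x)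
    xyz,zxy,yzx↛z : H xyz zxy yzx ≡ z → ⊥
    xyz,zxy,yzx↛z = λ e → sp-b xyz,zxy,zyx↦y e (prefer zyx z y)
    xyz,zxy,yzx↦y : H xyz zxy yzx ≡ y
    xyz,zxy,yzx↦y = isY xyz,zxy,yzx↛x xyz,zxy,yzx↛z
    xzy,zxy,yzx↛x : H xzy zxy yzx ≡ x → ⊥
    xzy,zxy,yzx↛x = λ e → sp-k xyz,zxy,yzx↦y e (prefer xyz x y)
    xyz,xzy,zyx↛x : H xyz xzy zyx ≡ x → ⊥
    xyz,xzy,zyx↛x = λ e → sp-a xyz,xyz,zyx↦y e (prefer xyz x y)
    xyz,xzy,zyx↛z : H xyz xzy zyx ≡ z → ⊥
    xyz,xzy,zyx↛z = λ e → sp-a xyz,zyx,zyx↦y e (prefer zyx z y)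
    xyz,xzy,zyx↦y : H xyz xzy zyx ≡ y
    xyz,xzy,zyx↦y = isY xyz,xzy,zyx↛x xyz,xzy,zyx↛z
    xyz,xzy,yzx↛x : H xyz xzy yzx ≡ x → ⊥
    xyz,xzy,yzx↛x = λ e → sp-b e xyz,xzy,zyx↦y (prefer yzx y x)
    xyz,xzy,yzx↛z : H xyz xzy yzx ≡ z → ⊥
    xyz,xzy,yzx↛z = λ e → sp-b xyz,xzy,zyx↦y e (prefer zyx z y)
    xyz,xzy,yzx↦y : H xyz xzy yzx ≡ y
    xyz,xzy,yzx↦y = isY xyz,xzy,yzx↛x xyz,xzy,yzx↛z
    xzy,xzy,yzx↛x : H xzy xzy yzx ≡ x → ⊥
    xzy,xzy,yzx↛x = λ e → sp-k xyz,xzy,yzx↦y e (prefer xyz x y)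
    xzy,xzy,yzx↛y : H xzy xzy yzx ≡ y → ⊥
    xzy,xzy,yzx↛y = λ e → sp-k e zyx,xzy,yzx↦z (prefer xzy z y)
    xzy,xzy,yzx↦z : H xzy xzy yzx ≡ z
    xzy,xzy,yzx↦z = isZ xzy,xzy,yzx↛x xzy,xzy,yzx↛y
    xzy,zxy,yzx↛y : H xzy zxy yzx ≡ y → ⊥
    xzy,zxy,yzx↛y = λ e → sp-a e xzy,xzy,yzx↦z (prefer zxy z y)
    xzy,zxy,yzx↦z : H xzy zxy yzx ≡ z
    xzy,zxy,yzx↦z = isZ xzy,zxy,yzx↛x xzy,zxy,yzx↛y
    xzy,zxy,yxz↛y : H xzy zxy yxz ≡ y → ⊥
    xzy,zxy,yxz↛y = λ e → sp-b xzy,zxy,yzx↦z e (prefer yzx y z)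
    xzy,zxy,yxz↦z : H xzy zxy yxz ≡ z
    xzy,zxy,yxz↦z = isZ xzy,zxy,yxz↛x xzy,zxy,yxz↛y
    zxy,zxy,yxz↛y : H zxy zxy yxz ≡ y → ⊥
    zxy,zxy,yxz↛y = λ e → sp-k e xzy,zxy,yxz↦z (prefer zxy z y)
    zxy,zxy,yxz↦z : H zxy zxy yxz ≡ z
    zxy,zxy,yxz↦z = isZ zxy,zxy,yxz↛x zxy,zxy,yxz↛y

  z-split-zyx : H zyx xzy yzx ≡ z → (H zxy xyz zyx ≡ z) ⊎ (H zxy zxy yxz ≡ z)
  z-split-zyx zyx,xzy,yzx↦z =
    caseX (H xyz xyz zyx) (inj₁ ∘ z-split-zyx-x zyx,xzy,yzx↦z) (inj₂ ∘ z-split-zyx-y zyx,xzy,yzx↦z)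
          (⊥-elim ∘ z-loses-xyz-xyz-zyx)

  z-persists-yzx : H zxy yxz yxz ≡ x → H zxy xyz zyx ≡ z → H zxy xyz yzx ≡ z
  z-persists-yzx zxy,yxz,yxz↦x zxy,xyz,zyx↦z = zxy,xyz,yzx↦z
    where
    zxy,xyz,yzx↛x : H zxy xyz yzx ≡ x → ⊥
    zxy,xyz,yzx↛x = λ e → sp-b e zxy,xyz,zyx↦z (prefer yzx z x)
    zxy,xyz,yxz↛y : H zxy xyz yxz ≡ y → ⊥
    zxy,xyz,yxz↛y = λ e → sp-a e zxy,yxz,yxz↦x (prefer xyz x y)
    zxy,xyz,yxz↛z : H zxy xyz yxz ≡ z → ⊥
    zxy,xyz,yxz↛z = λ e → sp-a e zxy,yxz,yxz↦x (prefer xyz x z)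
    zxy,xyz,yxz↦x : H zxy xyz yxz ≡ x
    zxy,xyz,yxz↦x = isX zxy,xyz,yxz↛y zxy,xyz,yxz↛z
    zxy,xyz,yzx↛y : H zxy xyz yzx ≡ y → ⊥
    zxy,xyz,yzx↛y = λ e → sp-b zxy,xyz,yxz↦x e (prefer yxz y x)
    zxy,xyz,yzx↦z : H zxy xyz yzx ≡ z
    zxy,xyz,yzx↦z = isZ zxy,xyz,yzx↛x zxy,xyz,yzx↛y


  raise-diag : ∀ K → H K (rev K) (rev K) {covering-rev K (rev K)} ≡
               H (raiseZ K) (rev (raiseZ K)) (rev (raiseZ K)) {covering-rev (raiseZ K) (rev (raiseZ K))}
  raise-diag xyz = raise-xyz
  raise-diag xzy = raise-xzy
  raise-diag yxz = raise-yxz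
  raise-diag yzx = raise-yzx
  raise-diag zxy = refl
  raise-diag zyx = refl

module TwoVoters {n : ℕ} (g : Rule n) (sp : StrategyProof g)
                 (a b : Fin n) (a≢b : ¬ (a ≡ b)) (agree⇒¬z : ∀ p np → p a ≡ p b → ¬ (g p np ≡ z)) where

  open Strategyproof g sp
  module Tab = Table g sp a b a≢b agree⇒¬z

  Canonical : Profile n → Set
  Canonical q = (q a ≡ q b) × Bot (q a) × OthersTop a b q

  dissenter : ∀ u (nu : NP u) → u a ≡ u b →
              Σ (Fin n) λ k → ¬ (k ≡ a) × ¬ (k ≡ b) × SameXY (u a) (rev (u k))
  dissenter u nu ua≡ub with ≻-total (u a) x y (λ ())
  ... | inj₁ x≻y with covNP nu y x (λ ())
  ...   | k , y≻x = k , k≢a , k≢b , trans (x≻y⇒xAboveY x≻y) (sym flipped)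
    where
    k≢a : ¬ (k ≡ a)
    k≢a refl = ≻-asym x≻y y≻x
    k≢b : ¬ (k ≡ b)
    k≢b refl = ≻-asym (subst (λ S → x ≻[ S ] y) ua≡ub x≻y) y≻x
    flipped : xAboveY (rev (u k)) ≡ true
    flipped = trans (xAboveY-rev (u k)) (cong not (y≻x⇒¬xAboveY y≻x))
  dissenter u nu ua≡ub | inj₂ y≻x with covNP nu x y (λ ())
  ...   | k , x≻y = k , k≢a , k≢b , trans (y≻x⇒¬xAboveY y≻x) (sym flipped)
    where
    k≢a : ¬ (k ≡ a)
    k≢a refl = ≻-asym x≻y y≻x
    k≢b : ¬ (k ≡ b)
    k≢b refl = ≻-asym x≻y (subst (λ S → y ≻[ S ] x) ua≡ub y≻x)
    flipped : xAboveY (rev (u k)) ≡ false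
    flipped = trans (xAboveY-rev (u k)) (cong not (x≻y⇒xAboveY x≻y))

  emb-OthersTop : ∀ {k} (k≢a : ¬ (k ≡ a)) (k≢b : ¬ (k ≡ b)) {bg : Profile n} → OthersTop a b bg →
                  ∀ {K A B} → Top K → OthersTop a b (Tab.emb k k≢a k≢b bg K A B)
  emb-OthersTop {k} k≢a k≢b {bg} bg-top {K} {A} {B} topK i i≢a i≢b with i ≟F k
  ... | yes refl = subst Top (sym (Tab.emb-k k k≢a k≢b bg)) topK
  ... | no i≢k = subst Top (sym (Tab.emb-other k k≢a k≢b bg i i≢a i≢b i≢k)) (bg-top i i≢a i≢b)

  -- With k a dissenter, A = u k and
  -- R = u a = u b: b switches to rev A, then a does; neither switch may be
  -- profitable, so by two-switches the outcome is that of the diagonal entry.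
  to-diagonal : ∀ u (nu : NP u) (ua≡ub : u a ≡ u b) {k} (k≢a : ¬ (k ≡ a)) (k≢b : ¬ (k ≡ b)) →
                SameXY (u a) (rev (u k)) →
                g u nu ≡ Tab.H k k≢a k≢b u (u k) (rev (u k)) (rev (u k)) {covering-rev (u k) (rev (u k))}
  to-diagonal u nu ua≡ub {k} k≢a k≢b dissent =
      two-switches dissent (agree⇒¬z u nu ua≡ub) U.diag≢z switch-b₁ switch-b₂
                   (U.sp-a {t = covering-rev A R} {covering-rev A (rev A)} refl refl)
                   (U.sp-a {t = covering-rev A (rev A)} {covering-rev A R} refl refl)
    where
    module U = Tab k k≢a k≢b u
    A R : L
    A = u k
    R = u a
    m : Profile n
    m = U.emb A R (rev A)
    m-NP : NP m
    m-NP = U.emb-NP (covering-rev A R)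
    u-variant : Variant b u m
    u-variant i i≢b = trans (U.variant-b i i≢b) (U.emb-≗ refl refl (sym ua≡ub) (λ _ _ _ _ → refl) i)
    switch-b₁ : ¬ (g m m-NP ≻[ R ] g u nu)
    switch-b₁ m≻u = sp b u m nu m-NP u-variant (subst (λ S → g m m-NP ≻[ S ] g u nu) ua≡ub m≻u)
    switch-b₂ : ¬ (g u nu ≻[ rev A ] g m m-NP)
    switch-b₂ u≻m = sp b m u m-NP nu (variant-sym u-variant)
                       (subst (λ S → g u nu ≻[ S ] g m m-NP) (sym U.emb-b) u≻m)

  CanonicalTwin : (u : Profile n) → NP u → Set
  CanonicalTwin u nu = Σ (Profile n) λ q → Σ (NP q) λ nq → Canonical q × (g q nq ≡ g u nu)

  -- Every NP* profile u has a canonical twin with the same outcome: after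
  -- to-diagonal, k raises z (raise-diag), and then all other voters raise z,
  -- keeping their x/y comparison; as a = b throughout, z never wins on the way.
  canonical-twin : ∀ u (nu : NP u) → u a ≡ u b → CanonicalTwin u nu
  canonical-twin u nu ua≡ub with dissenter u nu ua≡ub
  ... | k , k≢a , k≢b , dissent = q , q-NP , q-canonical , twin
    where
    module U = Tab k k≢a k≢b u
    module V = Tab k k≢a k≢b (raiseZ ∘ u)
    A' : L
    A' = raiseZ (u k)
    p₀ q : Profile n
    p₀ = U.emb A' (rev A') (rev A')
    q = V.emb A' (rev A') (rev A')
    p₀-NP : NP p₀
    p₀-NP = U.emb-NP (covering-rev A' (rev A'))
    q-NP : NP q
    q-NP = V.emb-NP (covering-rev A' (rev A'))
    q-canonical : Canonical q
    q-canonical = trans V.emb-a (sym V.emb-b) , subst Bot (sym V.emb-a) (rev-raiseZ-Bot (u k)) ,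
                  emb-OthersTop k≢a k≢b (λ i _ _ → raiseZ-Top (u i)) (raiseZ-Top (u k))
    move : ∀ i → (p₀ i ≡ q i) ⊎ SameXY (p₀ i) (q i)
    move = anchors-or k a b (trans U.emb-k (sym V.emb-k)) (trans U.emb-a (sym V.emb-a)) (trans U.emb-b (sym V.emb-b))
             (λ i i≢a i≢b i≢k → inj₂ (subst₂ SameXY (sym (U.emb-other i i≢a i≢b i≢k))
                                                      (sym (V.emb-other i i≢a i≢b i≢k))
                                                      (sym (xAboveY-raiseZ (u i)))))
    no-z : ∀ r nr → Mixture p₀ q r → ¬ (g r nr ≡ z)
    no-z r nr mr = agree⇒¬z r nr (trans (mixture-agree mr U.emb-a V.emb-a) (sym (mixture-agree mr U.emb-b V.emb-b)))
    twin : g q q-NP ≡ g u nu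
    twin = walk-anchored p₀ q k a b U.emb-k V.emb-k U.emb-a V.emb-a U.emb-b V.emb-b (covering-rev A' (rev A'))
             (step-same-xy (g u nu) move no-z) p₀-NP q-NP
             (sym (trans (to-diagonal u nu ua≡ub k≢a k≢b dissent) (U.raise-diag (u k))))

  -- The voter of a canonical profile who ranks x over y (or y over x) exists by
  -- NP and, ranking z first, reports zxy (resp. zyx).
  Reports : Profile n → L → Set
  Reports q K = Σ (Fin n) λ k → ¬ (k ≡ a) × ¬ (k ≡ b) × (q k ≡ K)

  top-x≻y : ∀ {R} → Top R → x ≻[ R ] y → R ≡ zxy
  top-x≻y (inj₁ e) _ = e
  top-x≻y (inj₂ refl) x≻y = ⊥-elim (≻-asym {zyx} {x} {y} x≻y (prefer zyx y x))

  top-y≻x : ∀ {R} → Top R → y ≻[ R ] x → R ≡ zyx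
  top-y≻x (inj₂ e) _ = e
  top-y≻x (inj₁ refl) y≻x = ⊥-elim (≻-asym {zxy} {y} {x} y≻x (prefer zxy x y))

  reports-zxy : ∀ q (nq : NP q) → Canonical q → q a ≡ yxz → Reports q zxy
  reports-zxy q nq (qa≡qb , _ , top) qa≡yxz with covNP nq x y (λ ())
  ... | k , x≻y = k , k≢a , k≢b , top-x≻y (top k k≢a k≢b) x≻y
    where
    k≢a : ¬ (k ≡ a)
    k≢a refl = ≻-asym {yxz} {x} {y} (subst (λ S → x ≻[ S ] y) qa≡yxz x≻y) (prefer yxz y x)
    k≢b : ¬ (k ≡ b)
    k≢b refl = ≻-asym {yxz} {x} {y} (subst (λ S → x ≻[ S ] y) (trans (sym qa≡qb) qa≡yxz) x≻y) (prefer yxz y x)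

  reports-zyx : ∀ q (nq : NP q) → Canonical q → q a ≡ xyz → Reports q zyx
  reports-zyx q nq (qa≡qb , _ , top) qa≡xyz with covNP nq y x (λ ())
  ... | k , y≻x = k , k≢a , k≢b , top-y≻x (top k k≢a k≢b) y≻x
    where
    k≢a : ¬ (k ≡ a)
    k≢a refl = ≻-asym {xyz} {y} {x} (subst (λ S → y ≻[ S ] x) qa≡xyz y≻x) (prefer xyz x y)
    k≢b : ¬ (k ≡ b)
    k≢b refl = ≻-asym {xyz} {y} {x} (subst (λ S → y ≻[ S ] x) (trans (sym qa≡qb) qa≡xyz) y≻x) (prefer xyz x y)

  np-xyz-yzx : ∀ {k} {r : Profile n} → r a ≡ xyz → r b ≡ yzx → Top (r k) → NP r
  np-xyz-yzx {k} ra rb (inj₁ rk) = covering-NP k a b rk ra rb _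
  np-xyz-yzx {k} ra rb (inj₂ rk) = covering-NP k a b rk ra rb _

  raise-z-xyz-yzx : ∀ {k} → ¬ (k ≡ a) → ¬ (k ≡ b) → ∀ s₁ (ns₁ : NP s₁) s₂ (ns₂ : NP s₂) →
                    s₁ a ≡ xyz → s₂ a ≡ xyz → s₁ b ≡ yzx → s₂ b ≡ yzx →
                    Top (s₁ k) → OthersTop a b s₂ →
                    g s₁ ns₁ ≡ z → g s₂ ns₂ ≡ z
  raise-z-xyz-yzx {k} k≢a k≢b s₁ ns₁ s₂ ns₂ s₁a s₂a s₁b s₂b top₁ top₂ =
    walk s₁ s₂ (λ j → np-xyz-yzx {k} (mixture-agree (mix-mixture j s₁ s₂) s₁a s₂a)
                                 (mixture-agree (mix-mixture j s₁ s₂) s₁b s₂b) (top-k (mix-mixture j s₁ s₂)))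
         (step-raise-z raise) ns₁ ns₂
    where
    top-k : ∀ {r} → Mixture s₁ s₂ r → Top (r k)
    top-k {r} mr with mr k
    ... | inj₁ e = subst Top (sym e) top₁
    ... | inj₂ e = subst Top (sym e) (top₂ k k≢a k≢b)
    raise : ∀ i → (s₁ i ≡ s₂ i) ⊎ Top (s₂ i)
    raise i with i ≟F a | i ≟F b
    ... | yes refl | _ = inj₁ (trans s₁a (sym s₂a))
    ... | no _ | yes refl = inj₁ (trans s₁b (sym s₂b))
    ... | no i≢a | no i≢b = inj₂ (top₂ i i≢a i≢b)

  ZForced : Set
  ZForced = ∀ q (nq : NP q) → q a ≡ xyz → q b ≡ zyx → OthersTop a b q → g q nq ≡ z

  module Forced (forced : ZForced) where

    -- A canonical profile with a = yxz and outcome x excludes one with a = xyz and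
    -- outcome y: the first leads (via the table and raising z) to z winning at
    -- a profile where b, reporting yzx, could secure y as in the second.
    not-x-yxz-and-y-xyz : ∀ q₁ (nq₁ : NP q₁) q₂ (nq₂ : NP q₂) →
                          Canonical q₁ → q₁ a ≡ yxz → g q₁ nq₁ ≡ x →
                          Canonical q₂ → q₂ a ≡ xyz → g q₂ nq₂ ≡ y → ⊥
    not-x-yxz-and-y-xyz q₁ nq₁ q₂ nq₂ c₁@(a≡b₁ , _ , top₁) a₁ x₁ (_ , _ , top₂) a₂ y₂
      with reports-zxy q₁ nq₁ c₁ a₁
    ... | k , k≢a , k≢b , k-zxy = z≢y (trans (sym s₂↦z) s₂↦y)
      where
      z≢y : ¬ (z ≡ y)
      z≢y ()
      module T₁ = Tab k k≢a k≢b q₁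
      zxy,yxz,yxz↦x : T₁.H zxy yxz yxz ≡ x
      zxy,yxz,yxz↦x =
        trans (T₁.H-≡-g nq₁ (T₁.emb-≗ k-zxy a₁ (trans (sym a≡b₁) a₁) (λ _ _ _ _ → refl))) x₁
      zxy,xyz,zyx↦z : T₁.H zxy xyz zyx ≡ z
      zxy,xyz,zyx↦z = forced _ _ T₁.emb-a T₁.emb-b (emb-OthersTop k≢a k≢b top₁ (inj₁ refl))
      s₂ : Profile n
      s₂ = q₂ [ b ≔ yzx ]
      s₂-a : s₂ a ≡ xyz
      s₂-a = trans (≔-other q₂ a≢b) a₂
      s₂-top : OthersTop a b s₂
      s₂-top i i≢a i≢b = subst Top (sym (≔-other q₂ i≢b)) (top₂ i i≢a i≢b)
      s₂-NP : NP s₂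
      s₂-NP = np-xyz-yzx {k} s₂-a (≔-here q₂ b) (s₂-top k k≢a k≢b)
      s₂↦z : g s₂ s₂-NP ≡ z
      s₂↦z = raise-z-xyz-yzx k≢a k≢b (T₁.emb zxy xyz yzx) (T₁.emb-NP _) s₂ s₂-NP
               T₁.emb-a s₂-a T₁.emb-b (≔-here q₂ b) (subst Top (sym T₁.emb-k) (inj₁ refl)) s₂-top
               (T₁.z-persists-yzx zxy,yxz,yxz↦x zxy,xyz,zyx↦z)
      s₂↦y : g s₂ s₂-NP ≡ y
      s₂↦y = mono-top (≔-variant q₂) y₂
               (λ u u≢y → subst (λ S → y ≻[ S ] u) (sym (≔-here q₂ b)) (y-top u u≢y))
        where
        y-top : ∀ u → ¬ (u ≡ y) → y ≻[ yzx ] u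
        y-top x _ = prefer yzx y x
        y-top y u≢y = ⊥-elim (u≢y refl)
        y-top z _ = prefer yzx y z

    module Const {k : Fin n} (k≢a : ¬ (k ≡ a)) (k≢b : ¬ (k ≡ b)) (c : L) (top-c : Top c) where
      open Tab k k≢a k≢b (const c) public

      canonical : ∀ {K A} → Top K → Bot A → Canonical (emb K A A)
      canonical topK botA = trans emb-a (sym emb-b) , subst Bot (sym emb-a) botA ,
                            emb-OthersTop k≢a k≢b (λ _ _ _ → top-c) topK

      zxy,xyz,zyx↦z : H zxy xyz zyx ≡ z
      zxy,xyz,zyx↦z = forced _ _ emb-a emb-b (emb-OthersTop k≢a k≢b (λ _ _ _ → top-c) (inj₁ refl))

    y-last-zxy : ∀ u → ¬ (u ≡ y) → u ≻[ zxy ] y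
    y-last-zxy x _ = prefer zxy x y
    y-last-zxy y u≢y = ⊥-elim (u≢y refl)
    y-last-zxy z _ = prefer zxy z y

    x-last-zyx : ∀ u → ¬ (u ≡ x) → u ≻[ zyx ] x
    x-last-zyx x u≢x = ⊥-elim (u≢x refl)
    x-last-zyx y _ = prefer zyx y x
    x-last-zyx z _ = prefer zyx z x

    -- The case a = yxz for the second profile is reduced
    -- to a table over the constant background zyx: the y-profile is moved there
    -- (voters reporting zxy rank y last), and the clash lemma of the table applies.
    not-x-yxz-and-y : ∀ q₁ (nq₁ : NP q₁) → Canonical q₁ → q₁ a ≡ yxz → g q₁ nq₁ ≡ x →
                      ∀ q₂ (nq₂ : NP q₂) → Canonical q₂ → g q₂ nq₂ ≡ y → ⊥
    not-x-yxz-and-y q₁ nq₁ c₁ a₁ x₁ q₂ nq₂ c₂@(a≡b₂ , inj₁ a₂ , _) y₂ =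
      not-x-yxz-and-y-xyz q₁ nq₁ q₂ nq₂ c₁ a₁ x₁ c₂ a₂ y₂
    not-x-yxz-and-y q₁ nq₁ c₁ a₁ x₁ q₂ nq₂ c₂@(a≡b₂ , inj₂ a₂ , top₂) y₂
      with reports-zxy q₂ nq₂ c₂ a₂
    ... | k , k≢a , k≢b , k-zxy = C.zxy-clash C.zxy,xyz,zyx↦z zxy,yxz,yxz↦y zyx,xyz,xyz↦x
      where
      module C = Const k≢a k≢b zyx (inj₂ refl)
      b₂ : q₂ b ≡ yxz
      b₂ = trans (sym a≡b₂) a₂
      move : ∀ i → (q₂ i ≡ C.emb zxy yxz yxz i) ⊎ (∀ u → ¬ (u ≡ y) → u ≻[ q₂ i ] y)
      move = anchors-or k a b (trans k-zxy (sym C.emb-k)) (trans a₂ (sym C.emb-a)) (trans b₂ (sym C.emb-b)) rest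
        where
        rest : ∀ i → ¬ (i ≡ a) → ¬ (i ≡ b) → ¬ (i ≡ k) →
               (q₂ i ≡ C.emb zxy yxz yxz i) ⊎ (∀ u → ¬ (u ≡ y) → u ≻[ q₂ i ] y)
        rest i i≢a i≢b i≢k with top₂ i i≢a i≢b
        ... | inj₁ is-zxy = inj₂ (λ u u≢y → subst (λ S → u ≻[ S ] y) (sym is-zxy) (y-last-zxy u u≢y))
        ... | inj₂ is-zyx = inj₁ (trans is-zyx (sym (C.emb-other i i≢a i≢b i≢k)))
      zxy,yxz,yxz↦y : C.H zxy yxz yxz ≡ y
      zxy,yxz,yxz↦y = walk-anchored q₂ (C.emb zxy yxz yxz) k a b k-zxy C.emb-k a₂ C.emb-a b₂ C.emb-b _
                        (step-from-last y move) nq₂ (C.emb-NP _) y₂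
      zyx,xyz,xyz↦x : C.H zyx xyz xyz ≡ x
      zyx,xyz,xyz↦x = caseX (C.H zyx xyz xyz) (λ e → e)
        (λ e → ⊥-elim (not-x-yxz-and-y-xyz q₁ nq₁ _ (C.emb-NP _) c₁ a₁ x₁
                                          (C.canonical (inj₂ refl) (inj₁ refl)) C.emb-a e))
        (⊥-elim ∘ C.diag≢z)

    -- The same with a = xyz in the x-profile: move it into a table over the
    -- constant background zxy (voters reporting zyx rank x last) and either reduce
    -- to the previous case or apply the clash lemma.
    not-x-xyz-and-y : ∀ q₁ (nq₁ : NP q₁) → Canonical q₁ → q₁ a ≡ xyz → g q₁ nq₁ ≡ x →
                      ∀ q₂ (nq₂ : NP q₂) → Canonical q₂ → g q₂ nq₂ ≡ y → ⊥
    not-x-xyz-and-y q₁ nq₁ c₁@(a≡b₁ , _ , top₁) a₁ x₁ q₂ nq₂ c₂ y₂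
      with reports-zyx q₁ nq₁ c₁ a₁
    ... | k , k≢a , k≢b , k-zyx =
      caseX (C.H zxy yxz yxz)
        (λ e → not-x-yxz-and-y _ (C.emb-NP _) (C.canonical (inj₁ refl) (inj₂ refl)) C.emb-a e q₂ nq₂ c₂ y₂)
        (λ e → C.zxy-clash C.zxy,xyz,zyx↦z e zyx,xyz,xyz↦x)
        C.diag≢z
      where
      module C = Const k≢a k≢b zxy (inj₁ refl)
      b₁ : q₁ b ≡ xyz
      b₁ = trans (sym a≡b₁) a₁
      move : ∀ i → (q₁ i ≡ C.emb zyx xyz xyz i) ⊎ (∀ u → ¬ (u ≡ x) → u ≻[ q₁ i ] x)
      move = anchors-or k a b (trans k-zyx (sym C.emb-k)) (trans a₁ (sym C.emb-a)) (trans b₁ (sym C.emb-b)) rest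
        where
        rest : ∀ i → ¬ (i ≡ a) → ¬ (i ≡ b) → ¬ (i ≡ k) →
               (q₁ i ≡ C.emb zyx xyz xyz i) ⊎ (∀ u → ¬ (u ≡ x) → u ≻[ q₁ i ] x)
        rest i i≢a i≢b i≢k with top₁ i i≢a i≢b
        ... | inj₁ is-zxy = inj₁ (trans is-zxy (sym (C.emb-other i i≢a i≢b i≢k)))
        ... | inj₂ is-zyx = inj₂ (λ u u≢x → subst (λ S → u ≻[ S ] x) (sym is-zyx) (x-last-zyx u u≢x))
      zyx,xyz,xyz↦x : C.H zyx xyz xyz ≡ x
      zyx,xyz,xyz↦x = walk-anchored q₁ (C.emb zyx xyz xyz) k a b k-zyx C.emb-k a₁ C.emb-a b₁ C.emb-b _
                        (step-from-last x move) nq₁ (C.emb-NP _) x₁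

    not-x-and-y : ∀ ux (nux : NP ux) → ux a ≡ ux b → g ux nux ≡ x →
                  ∀ uy (nuy : NP uy) → uy a ≡ uy b → g uy nuy ≡ y → ⊥
    not-x-and-y ux nux ux-agree ux↦x uy nuy uy-agree uy↦y =
      from-twins (canonical-twin ux nux ux-agree) (canonical-twin uy nuy uy-agree)
      where
      from-twins : CanonicalTwin ux nux → CanonicalTwin uy nuy → ⊥
      from-twins (q₁ , nq₁ , c₁@(_ , inj₁ a₁ , _) , twin₁) (q₂ , nq₂ , c₂ , twin₂) =
        not-x-xyz-and-y q₁ nq₁ c₁ a₁ (trans twin₁ ux↦x) q₂ nq₂ c₂ (trans twin₂ uy↦y)
      from-twins (q₁ , nq₁ , c₁@(_ , inj₂ a₁ , _) , twin₁) (q₂ , nq₂ , c₂ , twin₂) =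
        not-x-yxz-and-y q₁ nq₁ c₁ a₁ (trans twin₁ ux↦x) q₂ nq₂ c₂ (trans twin₂ uy↦y)

  raise-z-elsewhere : ∀ p (np : NP p) q (nq : NP q) (k : Fin n) {K A B} →
                      p k ≡ K → q k ≡ K → p a ≡ A → q a ≡ A → p b ≡ B → q b ≡ B → Covering K A B →
                      (∀ i → ¬ (i ≡ a) → ¬ (i ≡ b) → ¬ (i ≡ k) → Top (q i)) →
                      g p np ≡ z → g q nq ≡ z
  raise-z-elsewhere p np q nq k pk qk pa qa pb qb cov top =
    walk-anchored p q k a b pk qk pa qa pb qb cov
      (step-raise-z (anchors-or k a b (trans pk (sym qk)) (trans pa (sym qa)) (trans pb (sym qb))
                                (λ i i≢a i≢b i≢k → inj₂ (top i i≢a i≢b i≢k))))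
      np nq

  forced-from : ∀ r (nr : NP r) → g r nr ≡ z → r a ≡ xyz → r b ≡ zyx → ZForced
  forced-from r nr win ra rb q nq qa qb top =
    raise-z-elsewhere r nr q nq a ra qa ra qa rb qb _ (λ i i≢a i≢b _ → top i i≢a i≢b) win

  raised : Profile n → L → L → Profile n
  raised p A B = (raiseZ ∘ p) [ b ≔ B ] [ a ≔ A ]

  raised-a : ∀ {p A B} → raised p A B a ≡ A
  raised-a = ≔-here _ a

  raised-b : ∀ {p A B} → raised p A B b ≡ B
  raised-b = trans (≔-other _ (a≢b ∘ sym)) (≔-here _ b)

  raised-top : ∀ {p A B} → OthersTop a b (raised p A B)
  raised-top {p} i i≢a i≢b = subst Top (sym (trans (≔-other _ i≢a) (≔-other _ i≢b))) (raiseZ-Top (p i))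

  raise-z : ∀ p (np : NP p) {A B} → p a ≡ A → p b ≡ B → (cov : Covering A A B) → g p np ≡ z →
            g (raised p A B) (covering-NP a a b raised-a raised-a raised-b cov) ≡ z
  raise-z p np {A} {B} pa pb cov =
    raise-z-elsewhere p np (raised p A B) _ a pa raised-a pa raised-a pb raised-b cov
                      (λ i i≢a i≢b _ → raised-top i i≢a i≢b)

  module Reach (o : Fin n) (o≢a : ¬ (o ≡ a)) (o≢b : ¬ (o ≡ b)) where

    b≢a : ¬ (b ≡ a)
    b≢a = a≢b ∘ sym

    -- A z-anchored profile gives ZForced: a and b move to xyz and zyx without
    -- lowering z (a ranked z last, zyx ranks z first); when a = yxz and b = zxy
    -- the order of the two moves is chosen so that o keeps the profile in NP.
    anchored⇒forced : ZAnchored a b → ZForced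
    anchored⇒forced (q , nq , win , inj₁ qa , inj₂ qb , _) = forced-from q nq win qa qb
    anchored⇒forced (q , nq , win , inj₁ qa , inj₁ qb , _) =
      forced-from q' nq' (keep-z q nq b zyx nq' win (z-up-to-top zyx (inj₂ refl))) q'a (≔-here q b)
      where
      q' : Profile n
      q' = q [ b ≔ zyx ]
      q'a : q' a ≡ xyz
      q'a = trans (≔-other q a≢b) qa
      nq' : NP q'
      nq' = covering-NP a a b q'a q'a (≔-here q b) _
    anchored⇒forced (q , nq , win , inj₂ qa , inj₂ qb , _) =
      forced-from q' nq' (keep-z q nq a xyz nq' win (z-up-from-bottom xyz (inj₂ qa))) (≔-here q a) q'b
      where
      q' : Profile n
      q' = q [ a ≔ xyz ]
      q'b : q' b ≡ zyx
      q'b = trans (≔-other q b≢a) qb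
      nq' : NP q'
      nq' = covering-NP a a b (≔-here q a) (≔-here q a) q'b _
    anchored⇒forced (q , nq , win , inj₂ qa , inj₁ qb , top) with top o o≢a o≢b
    ... | inj₂ qo = forced-from q₂ nq₂ win₂ q₂a (≔-here q₁ b)
      where
      q₁ q₂ : Profile n
      q₁ = q [ a ≔ xyz ]
      q₂ = q₁ [ b ≔ zyx ]
      nq₁ : NP q₁
      nq₁ = covering-NP o a b (trans (≔-other q o≢a) qo) (≔-here q a) (trans (≔-other q b≢a) qb) _
      win₁ : g q₁ nq₁ ≡ z
      win₁ = keep-z q nq a xyz nq₁ win (z-up-from-bottom xyz (inj₂ qa))
      q₂a : q₂ a ≡ xyz
      q₂a = trans (≔-other q₁ a≢b) (≔-here q a)
      nq₂ : NP q₂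
      nq₂ = covering-NP a a b q₂a q₂a (≔-here q₁ b) _
      win₂ : g q₂ nq₂ ≡ z
      win₂ = keep-z q₁ nq₁ b zyx nq₂ win₁ (z-up-to-top zyx (inj₂ refl))
    ... | inj₁ qo = forced-from q₂ nq₂ win₂ (≔-here q₁ a) q₂b
      where
      q₁ q₂ : Profile n
      q₁ = q [ b ≔ zyx ]
      q₂ = q₁ [ a ≔ xyz ]
      nq₁ : NP q₁
      nq₁ = covering-NP o a b (trans (≔-other q o≢b) qo) (trans (≔-other q a≢b) qa) (≔-here q b) _
      win₁ : g q₁ nq₁ ≡ z
      win₁ = keep-z q nq b zyx nq₁ win (z-up-to-top zyx (inj₂ refl))
      q₂b : q₂ b ≡ zyx
      q₂b = trans (≔-other q₁ b≢a) (≔-here q b)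
      nq₂ : NP q₂
      nq₂ = covering-NP a a b (≔-here q₁ a) (≔-here q₁ a) q₂b _
      win₂ : g q₂ nq₂ ≡ z
      win₂ = keep-z q₁ nq₁ a xyz nq₂ win₁
               (z-up-from-bottom xyz (subst Bot (sym (trans (≔-other q a≢b) qa)) (inj₂ refl)))

    -- If z wins, the voters other than a and b cannot contain both a voter ranking
    -- x above z and one ranking y above z: otherwise a and b could both move to an
    -- ordering S with z first (keeping z the winner, and the profile in NP thanks
    -- to those two voters), and then agree.
    z-lacks-support : ∀ p (np : NP p) → g p np ≡ z →
                      ∀ i → ¬ (i ≡ a) → ¬ (i ≡ b) → x ≻[ p i ] z →
                      ∀ j → ¬ (j ≡ a) → ¬ (j ≡ b) → y ≻[ p j ] z → ⊥
    z-lacks-support p np win i i≢a i≢b x≻z j j≢a j≢b y≻z =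
      agree⇒¬z q₂ nq₂ (trans q₂a (sym (≔-here q₁ b))) win₂
      where
      S : L
      S = raiseZ (rev (p i))
      topS : Top S
      topS = raiseZ-Top (rev (p i))
      np-with : ∀ r → r i ≡ p i → r j ≡ p j → r a ≡ S → NP r
      np-with r ri rj ra with ≻-total (p i) x y (λ ())
      ... | inj₁ x≻y = mkNP (cov-at i ri x≻y) (cov-at a ra (opposite-top-x x≻y)) (cov-at i ri x≻z)
                            (cov-at a ra (Top-z topS x (λ ()))) (cov-at j rj y≻z) (cov-at a ra (Top-z topS y (λ ())))
      ... | inj₂ y≻x = mkNP (cov-at a ra (opposite-top-y y≻x)) (cov-at i ri y≻x) (cov-at i ri x≻z)
                            (cov-at a ra (Top-z topS x (λ ()))) (cov-at j rj y≻z) (cov-at a ra (Top-z topS y (λ ())))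
      q₁ q₂ : Profile n
      q₁ = p [ a ≔ S ]
      q₂ = q₁ [ b ≔ S ]
      q₂a : q₂ a ≡ S
      q₂a = trans (≔-other q₁ a≢b) (≔-here p a)
      nq₁ : NP q₁
      nq₁ = np-with q₁ (≔-other p i≢a) (≔-other p j≢a) (≔-here p a)
      nq₂ : NP q₂
      nq₂ = np-with q₂ (trans (≔-other q₁ i≢b) (≔-other p i≢a))
                       (trans (≔-other q₁ j≢b) (≔-other p j≢a)) q₂a
      win₂ : g q₂ nq₂ ≡ z
      win₂ = keep-z q₁ nq₁ b S nq₂ (keep-z p np a S nq₁ win (z-up-to-top S topS)) (z-up-to-top S topS)

    -- If a ranks z last (A), let b report rev A, which ranks z first, and let
    -- everybody else raise z.
    anchored-if-a-bottom : ∀ p (np : NP p) → g p np ≡ z → ∀ {A} → p a ≡ A → Bot A → ZAnchored a b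
    anchored-if-a-bottom p np win {A} pa botA =
        raised p₁ A (rev A) , _ , raise-z p₁ np₁ p₁a (≔-here p b) (covering-rev A A) win₁ ,
        subst Bot (sym raised-a) botA , subst Top (sym raised-b) (Bot-rev-Top botA) , raised-top
      where
      p₁ : Profile n
      p₁ = p [ b ≔ rev A ]
      p₁a : p₁ a ≡ A
      p₁a = trans (≔-other p a≢b) pa
      np₁ : NP p₁
      np₁ = covering-NP a a b p₁a p₁a (≔-here p b) (covering-rev A A)
      win₁ : g p₁ np₁ ≡ z
      win₁ = keep-z p np b (rev A) np₁ win (z-up-to-top (rev A) (Bot-rev-Top botA))

    module Cells {k : Fin n} (k≢a : ¬ (k ≡ a)) (k≢b : ¬ (k ≡ b)) (bg : Profile n) (bg-top : OthersTop a b bg) where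
      open Tab k k≢a k≢b bg

      anchored-cell : H zxy xyz zyx ≡ z → ZAnchored a b
      anchored-cell win = _ , _ , win , subst Bot (sym emb-a) (inj₁ refl) , subst Top (sym emb-b) (inj₂ refl) ,
                          emb-OthersTop k≢a k≢b bg-top (inj₁ refl)

      swapped-cell : H zxy zxy yxz ≡ z → ZAnchored b a
      swapped-cell win = _ , _ , win , subst Bot (sym emb-b) (inj₂ refl) , subst Top (sym emb-a) (inj₁ refl) ,
                         λ i i≢b i≢a → emb-OthersTop k≢a k≢b bg-top (inj₁ refl) i i≢a i≢b

    -- a = xzy, b = yzx: after everybody else raises z, o reports zxy or zyx and the
    -- corresponding table lemma splits into the two anchored shapes.
    anchored-if-xzy-yzx : ∀ p (np : NP p) → g p np ≡ z → p a ≡ xzy → p b ≡ yzx →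
                          ZAnchored a b ⊎ ZAnchored b a
    anchored-if-xzy-yzx p np win pa pb = split (raiseZ-Top (p o))
      where
      q : Profile n
      q = raised p xzy yzx
      q-NP : NP q
      q-NP = covering-NP a a b raised-a raised-a raised-b _
      module E = Tab o o≢a o≢b q
      module C = Cells o≢a o≢b q raised-top
      entry : ∀ {K} → raiseZ (p o) ≡ K → (cov : Covering K xzy yzx) → E.H K xzy yzx {cov} ≡ z
      entry po cov = trans (E.H-≡-g q-NP (E.emb-≗ (trans (trans (≔-other _ o≢a) (≔-other _ o≢b)) po)
                                                  raised-a raised-b (λ _ _ _ _ → refl)))
                           (raise-z p np pa pb _ win)
      split : Top (raiseZ (p o)) → ZAnchored a b ⊎ ZAnchored b a
      split (inj₁ po) = Sum.map C.anchored-cell C.swapped-cell (E.z-split-zxy (entry po _))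
      split (inj₂ po) = Sum.map C.anchored-cell C.swapped-cell (E.z-split-zyx (entry po _))

    supporter : ∀ {p u} → Cov p u z → z ≻[ p a ] u → Top (p b) → ¬ (u ≡ z) →
                Σ (Fin n) λ i → ¬ (i ≡ a) × ¬ (i ≡ b) × (u ≻[ p i ] z)
    supporter {p} {u} (i , u≻z) z≻u topb u≢z =
      i , (λ { refl → ≻-asym {p a} {u} {z} u≻z z≻u }) ,
          (λ { refl → ≻-asym {p b} {u} {z} u≻z (Top-z topb u u≢z) }) , u≻z

    -- Some voter i ranks x above z; by z-lacks-support
    -- nobody else outside {a, b} ranks y above z, so i reports xzy.  Raising z
    -- elsewhere gives the table entry (xzy, yzx, p b), which spreads to the
    -- anchored entry.
    anchored-if-yzx-top : ∀ p (np : NP p) → g p np ≡ z → p a ≡ yzx → Top (p b) → ZAnchored a b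
    anchored-if-yzx-top p np win pa topb
      with supporter (covNP np x z (λ ())) (subst (λ S → z ≻[ S ] x) (sym pa) (prefer yzx z x)) topb (λ ())
    ... | i , i≢a , i≢b , x≻z
      with any? {P = λ j → ¬ (j ≡ a) × ¬ (j ≡ b) × (y ≻[ p j ] z)}
                (λ j → ¬? (j ≟F a) ×-dec (¬? (j ≟F b) ×-dec (rank (p j) y ℕP.<? rank (p j) z)))
    ...   | yes (j , j≢a , j≢b , y≻z) = ⊥-elim (z-lacks-support p np win i i≢a i≢b x≻z j j≢a j≢b y≻z)
    ...   | no none = Cells.anchored-cell i≢a i≢b (raiseZ ∘ p) (λ j _ _ → raiseZ-Top (p j)) (spread topb)
      where
      module E = Tab i i≢a i≢b (raiseZ ∘ p)
      pi : p i ≡ xzy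
      pi = xzy-only (p i) x≻z (λ y≻z → none (i , i≢a , i≢b , y≻z))
      entry : ∀ {B} → p b ≡ B → (cov : Covering xzy yzx B) → E.H xzy yzx B {cov} ≡ z
      entry pb cov = raise-z-elsewhere p np _ (E.emb-NP cov) i pi E.emb-k pa E.emb-a pb E.emb-b cov
                       (λ j j≢a j≢b j≢i → subst Top (sym (E.emb-other j j≢a j≢b j≢i)) (raiseZ-Top (p j))) win
      spread : Top (p b) → E.H zxy xyz zyx ≡ z
      spread (inj₁ pb) = E.z-spread-xzy-zxy (entry pb _)
      spread (inj₂ pb) = E.z-spread-xzy-zyx (entry pb _)

    anchored-if-xzy-top : ∀ p (np : NP p) → g p np ≡ z → p a ≡ xzy → Top (p b) → ZAnchored a b
    anchored-if-xzy-top p np win pa topb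
      with supporter (covNP np y z (λ ())) (subst (λ S → z ≻[ S ] y) (sym pa) (prefer xzy z y)) topb (λ ())
    ... | i , i≢a , i≢b , y≻z
      with any? {P = λ j → ¬ (j ≡ a) × ¬ (j ≡ b) × (x ≻[ p j ] z)}
                (λ j → ¬? (j ≟F a) ×-dec (¬? (j ≟F b) ×-dec (rank (p j) x ℕP.<? rank (p j) z)))
    ...   | yes (j , j≢a , j≢b , x≻z) = ⊥-elim (z-lacks-support p np win j j≢a j≢b x≻z i i≢a i≢b y≻z)
    ...   | no none = Cells.anchored-cell i≢a i≢b (raiseZ ∘ p) (λ j _ _ → raiseZ-Top (p j)) (spread topb)
      where
      module E = Tab i i≢a i≢b (raiseZ ∘ p)
      pi : p i ≡ yzx
      pi = yzx-only (p i) y≻z (λ x≻z → none (i , i≢a , i≢b , x≻z))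
      entry : ∀ {B} → p b ≡ B → (cov : Covering yzx xzy B) → E.H yzx xzy B {cov} ≡ z
      entry pb cov = raise-z-elsewhere p np _ (E.emb-NP cov) i pi E.emb-k pa E.emb-a pb E.emb-b cov
                       (λ j j≢a j≢b j≢i → subst Top (sym (E.emb-other j j≢a j≢b j≢i)) (raiseZ-Top (p j))) win
      spread : Top (p b) → E.H zxy xyz zyx ≡ z
      spread (inj₁ pb) = E.z-spread-yzx-zxy (entry pb _)
      spread (inj₂ pb) = E.z-spread-yzx-zyx (entry pb _)

module Main {n : ℕ} (g : Rule n) (sp : StrategyProof g) {a b o : Fin n} (a≢b : ¬ (a ≡ b))
            (o≢a : ¬ (o ≡ a)) (o≢b : ¬ (o ≡ b)) (agree⇒¬z : ∀ p np → p a ≡ p b → ¬ (g p np ≡ z)) where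

  open Strategyproof g sp using (ZAnchored)
  module AB = TwoVoters g sp a b a≢b agree⇒¬z
  module BA = TwoVoters g sp b a (a≢b ∘ sym) (λ p np → agree⇒¬z p np ∘ sym)
  module RAB = AB.Reach o o≢a o≢b
  module RBA = BA.Reach o o≢b o≢a

  anchored : ∀ p (np : NP p) → g p np ≡ z → ZAnchored a b ⊎ ZAnchored b a
  anchored p np win = cases (p a) (p b) refl refl
    where
    both-top : Top (p a) → Top (p b) → ⊥
    both-top top-a top-b with RAB.supporter (covNP np x z (λ ())) (Top-z top-a x (λ ())) top-b (λ ())
                            | RAB.supporter (covNP np y z (λ ())) (Top-z top-a y (λ ())) top-b (λ ())
    ... | i , i≢a , i≢b , x≻z | j , j≢a , j≢b , y≻z =
      RAB.z-lacks-support p np win i i≢a i≢b x≻z j j≢a j≢b y≻z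
    agree : p a ≡ p b → ⊥
    agree pa≡pb = agree⇒¬z p np pa≡pb win
    cases : ∀ A B → p a ≡ A → p b ≡ B → ZAnchored a b ⊎ ZAnchored b a
    cases xyz _ pa _ = inj₁ (RAB.anchored-if-a-bottom p np win pa (inj₁ refl))
    cases yxz _ pa _ = inj₁ (RAB.anchored-if-a-bottom p np win pa (inj₂ refl))
    cases _ xyz _ pb = inj₂ (RBA.anchored-if-a-bottom p np win pb (inj₁ refl))
    cases _ yxz _ pb = inj₂ (RBA.anchored-if-a-bottom p np win pb (inj₂ refl))
    cases xzy yzx pa pb = RAB.anchored-if-xzy-yzx p np win pa pb
    cases yzx xzy pa pb = Sum.swap (RBA.anchored-if-xzy-yzx p np win pb pa)
    cases yzx zxy pa pb = inj₁ (RAB.anchored-if-yzx-top p np win pa (inj₁ pb))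
    cases yzx zyx pa pb = inj₁ (RAB.anchored-if-yzx-top p np win pa (inj₂ pb))
    cases zxy yzx pa pb = inj₂ (RBA.anchored-if-yzx-top p np win pb (inj₁ pa))
    cases zyx yzx pa pb = inj₂ (RBA.anchored-if-yzx-top p np win pb (inj₂ pa))
    cases xzy zxy pa pb = inj₁ (RAB.anchored-if-xzy-top p np win pa (inj₁ pb))
    cases xzy zyx pa pb = inj₁ (RAB.anchored-if-xzy-top p np win pa (inj₂ pb))
    cases zxy xzy pa pb = inj₂ (RBA.anchored-if-xzy-top p np win pb (inj₁ pa))
    cases zyx xzy pa pb = inj₂ (RBA.anchored-if-xzy-top p np win pb (inj₂ pa))
    cases zxy zyx pa pb = ⊥-elim (both-top (inj₁ pa) (inj₂ pb))
    cases zyx zxy pa pb = ⊥-elim (both-top (inj₂ pa) (inj₁ pb))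
    cases xzy xzy pa pb = ⊥-elim (agree (trans pa (sym pb)))
    cases yzx yzx pa pb = ⊥-elim (agree (trans pa (sym pb)))
    cases zxy zxy pa pb = ⊥-elim (agree (trans pa (sym pb)))
    cases zyx zyx pa pb = ⊥-elim (agree (trans pa (sym pb)))

  no-z : ∀ ux (nux : NP ux) → ux a ≡ ux b → g ux nux ≡ x →
         ∀ uy (nuy : NP uy) → uy a ≡ uy b → g uy nuy ≡ y →
         ∀ p (np : NP p) → ¬ (g p np ≡ z)
  no-z ux nux ux-agree ux↦x uy nuy uy-agree uy↦y p np win with anchored p np win
  ... | inj₁ anch = AB.Forced.not-x-and-y (RAB.anchored⇒forced anch) ux nux ux-agree ux↦x uy nuy uy-agree uy↦y
  ... | inj₂ anch = BA.Forced.not-x-and-y (RBA.anchored⇒forced anch)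
                      ux nux (sym ux-agree) ux↦x uy nuy (sym uy-agree) uy↦y

record Relabelling : Set where
  field
    σ : X → X
    σL : L → L
    σ-invol : ∀ u → σ (σ u) ≡ u
    σL-invol : ∀ R → σL (σL R) ≡ R
    rank-σL : ∀ R u → rank (σL R) u ≡ rank R (σ u)

  σ-injective : ∀ {u v} → σ u ≡ σ v → u ≡ v
  σ-injective {u} {v} e = trans (sym (σ-invol u)) (trans (cong σ e) (σ-invol v))

identity : Relabelling
identity = record { σ = λ u → u ; σL = λ R → R
                  ; σ-invol = λ _ → refl ; σL-invol = λ _ → refl ; rank-σL = λ _ _ → refl }

swap-xz : Relabelling
swap-xz = record { σ = σ ; σL = σL ; σ-invol = σ-invol ; σL-invol = σL-invol ; rank-σL = rank-σL }
  where
  σ : X → X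
  σ x = z
  σ y = y
  σ z = x
  σL : L → L
  σL xyz = zyx
  σL xzy = zxy
  σL yxz = yzx
  σL yzx = yxz
  σL zxy = xzy
  σL zyx = xyz
  σ-invol : ∀ u → σ (σ u) ≡ u
  σ-invol = λ { x → refl ; y → refl ; z → refl }
  σL-invol : ∀ R → σL (σL R) ≡ R
  σL-invol = λ { xyz → refl ; xzy → refl ; yxz → refl ; yzx → refl ; zxy → refl ; zyx → refl }
  rank-σL : ∀ R u → rank (σL R) u ≡ rank R (σ u)
  rank-σL xyz = λ { x → refl ; y → refl ; z → refl }
  rank-σL xzy = λ { x → refl ; y → refl ; z → refl }
  rank-σL yxz = λ { x → refl ; y → refl ; z → refl }
  rank-σL yzx = λ { x → refl ; y → refl ; z → refl }
  rank-σL zxy = λ { x → refl ; y → refl ; z → refl }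
  rank-σL zyx = λ { x → refl ; y → refl ; z → refl }

swap-yz : Relabelling
swap-yz = record { σ = σ ; σL = σL ; σ-invol = σ-invol ; σL-invol = σL-invol ; rank-σL = rank-σL }
  where
  σ : X → X
  σ x = x
  σ y = z
  σ z = y
  σL : L → L
  σL xyz = xzy
  σL xzy = xyz
  σL yxz = zxy
  σL yzx = zyx
  σL zxy = yxz
  σL zyx = yzx
  σ-invol : ∀ u → σ (σ u) ≡ u
  σ-invol = λ { x → refl ; y → refl ; z → refl }
  σL-invol : ∀ R → σL (σL R) ≡ R
  σL-invol = λ { xyz → refl ; xzy → refl ; yxz → refl ; yzx → refl ; zxy → refl ; zyx → refl }
  rank-σL : ∀ R u → rank (σL R) u ≡ rank R (σ u)
  rank-σL xyz = λ { x → refl ; y → refl ; z → refl }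
  rank-σL xzy = λ { x → refl ; y → refl ; z → refl }
  rank-σL yxz = λ { x → refl ; y → refl ; z → refl }
  rank-σL yzx = λ { x → refl ; y → refl ; z → refl }
  rank-σL zxy = λ { x → refl ; y → refl ; z → refl }
  rank-σL zyx = λ { x → refl ; y → refl ; z → refl }

to-z : X → Relabelling
to-z x = swap-xz
to-z y = swap-yz
to-z z = identity

to-z-sends : ∀ C → Relabelling.σ (to-z C) C ≡ z
to-z-sends x = refl
to-z-sends y = refl
to-z-sends z = refl

module Relabelled (P : Relabelling) {n : ℕ} (g : Rule n) (sp : StrategyProof g) where
  open Relabelling P

  relabel : Profile n → Profile n
  relabel p = σL ∘ p

  relabel-NP : ∀ {p} → NP p → NP (relabel p)
  relabel-NP {p} np u v u≢v with np (σ u) (σ v) (u≢v ∘ σ-injective)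
  ... | i , j , σu≻σv , σv≻σu = i , j , subst₂ ℕ._<_ (sym (rank-σL (p i) u)) (sym (rank-σL (p i) v)) σu≻σv ,
                                        subst₂ ℕ._<_ (sym (rank-σL (p j) v)) (sym (rank-σL (p j) u)) σv≻σu

  gσ : Rule n
  gσ p np = σ (g (relabel p) (relabel-NP np))

  gσ-sp : StrategyProof gσ
  gσ-sp h p p' np np' var gain =
    sp h (relabel p) (relabel p') (relabel-NP np) (relabel-NP np') (λ i i≢h → cong σL (var i i≢h))
       (subst₂ ℕ._<_ (sym (rank-σL (p h) _)) (sym (rank-σL (p h) _)) gain)

  gσ-relabel : ∀ p (np : NP p) (np' : NP (relabel p)) → gσ (relabel p) np' ≡ σ (g p np)
  gσ-relabel p np np' = cong σ (Strategyproof.g-ext g sp (relabel-NP np') np (λ i → σL-invol (p i)))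

module Voters (m : ℕ) where

  toℕ-penult : toℕ (penultI m) ≡ suc m
  toℕ-penult = trans (toℕ-inject₁ (fromℕ (suc m))) (toℕ-fromℕ (suc m))

  penult≢last : ¬ (penultI m ≡ lastI m)
  penult≢last e =
    <⇒≢ (ℕP.n<1+n (suc m)) (trans (sym toℕ-penult) (trans (cong toℕ e) (toℕ-fromℕ (suc (suc m)))))

  first≢penult : ¬ (Fin.zero ≡ penultI m)
  first≢penult e = 0≢1+n (trans (cong toℕ e) toℕ-penult)

  first≢last : ¬ (Fin.zero ≡ lastI m)
  first≢last e = 0≢1+n (trans (cong toℕ e) (toℕ-fromℕ (suc (suc m))))

no-z-outcome : ∀ m (g : Rule (suc (suc (suc m)))) → StrategyProof g →
               (∀ p np → p (penultI m) ≡ p (lastI m) → ¬ (g p np ≡ z)) →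
               InRangeStar m g x → InRangeStar m g y → ¬ InRange g z
no-z-outcome m g sp agree⇒¬z (ux , (nux , ux-agree) , ux↦x) (uy , (nuy , uy-agree) , uy↦y) (p , np , p↦z) =
  Main.no-z g sp penult≢last first≢penult first≢last agree⇒¬z
            ux nux ux-agree ux↦x uy nuy uy-agree uy↦y p np p↦z
  where open Voters m

x-and-y : ∀ {P : X → Set} {w w'} → P w → P w' → ¬ (w ≡ z) → ¬ (w' ≡ z) → ¬ (w ≡ w') → P x × P y
x-and-y {w = x} {x} _ _ _ _ w≢w' = ⊥-elim (w≢w' refl)
x-and-y {w = x} {y} Pw Pw' _ _ _ = Pw , Pw'
x-and-y {w = y} {x} Pw Pw' _ _ _ = Pw' , Pw
x-and-y {w = y} {y} _ _ _ _ w≢w' = ⊥-elim (w≢w' refl)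
x-and-y {w = z} _ _ w≢z _ _ = ⊥-elim (w≢z refl)
x-and-y {w' = z} _ _ _ w'≢z _ = ⊥-elim (w'≢z refl)

third : ∀ (A B : X) → ¬ (A ≡ B) → Σ X λ C → ¬ (C ≡ A) × ¬ (C ≡ B)
third x y _ = z , (λ ()) , (λ ())
third y x _ = z , (λ ()) , (λ ())
third x z _ = y , (λ ()) , (λ ())
third z x _ = y , (λ ()) , (λ ())
third y z _ = x , (λ ()) , (λ ())
third z y _ = x , (λ ()) , (λ ())
third x x A≢B = ⊥-elim (A≢B refl)
third y y A≢B = ⊥-elim (A≢B refl)
third z z A≢B = ⊥-elim (A≢B refl)

module Transport (m : ℕ) (P : Relabelling) (g : Rule (suc (suc (suc m)))) (sp : StrategyProof g) where
  open Relabelling P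
  open Relabelled P g sp

  star-outcome : ∀ {w} → InRangeStar m g w → InRangeStar m gσ (σ w)
  star-outcome (u , (nu , agree) , u↦w) =
    relabel u , (relabel-NP nu , cong σL agree) , trans (gσ-relabel u nu (relabel-NP nu)) (cong σ u↦w)

  outcome : ∀ {w} → InRange g w → InRange gσ (σ w)
  outcome (p , np , p↦w) = relabel p , relabel-NP np , trans (gσ-relabel p np (relabel-NP np)) (cong σ p↦w)

  star-preimage : ∀ p (np : NP p) → p (penultI m) ≡ p (lastI m) →
                  InRangeStar m g (g (relabel p) (relabel-NP np))
  star-preimage p np agree = relabel p , (relabel-NP np , cong σL agree) , refl

mainTheorem2 : (m : ℕ) (g : Rule (suc (suc (suc m)))) →
    StrategyProof g → RangeStarExactlyTwo m g →
    ¬ (∀ (w : X) → InRange g w)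
mainTheorem2 m g sp (A , B , A≢B , A-star , B-star , only-A-B) onto with third A B A≢B
... | C , C≢A , C≢B =
  no-z-outcome m gσ gσ-sp agree⇒¬z (proj₁ xy) (proj₂ xy) (subst (InRange gσ) (to-z-sends C) (outcome (onto C)))
  where
  P : Relabelling
  P = to-z C
  open Relabelling P
  open Relabelled P g sp
  open Transport m P g sp
  -- σ w = z only for w = C, which is not an NP* outcome of g.
  σ≢z : ∀ {w} → ¬ (w ≡ C) → ¬ (σ w ≡ z)
  σ≢z w≢C σw≡z = w≢C (σ-injective (trans σw≡z (sym (to-z-sends C))))
  agree⇒¬z : ∀ p np → p (penultI m) ≡ p (lastI m) → ¬ (gσ p np ≡ z)
  agree⇒¬z p np agree with only-A-B _ (star-preimage p np agree)
  ... | inj₁ is-A = σ≢z (λ e → C≢A (trans (sym e) is-A))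
  ... | inj₂ is-B = σ≢z (λ e → C≢B (trans (sym e) is-B))
  xy : InRangeStar m gσ x × InRangeStar m gσ y
  xy = x-and-y {P = InRangeStar m gσ} (star-outcome A-star) (star-outcome B-star)
               (σ≢z (C≢A ∘ sym)) (σ≢z (C≢B ∘ sym)) (A≢B ∘ σ-injective)
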